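{- Let $k$ be a natural number. If a graph contains a cycle and a path which are $18k^2$-close, then it contains a $\theta(k,1)$-necklace or a $\theta(k,2)$-necklace.
   Context: All graphs are finite and simple. A subcubic graph has maximum degree at most 3. An $A-B$ path is a path with one end in $A$, one end in $B$, and no internal vertex in $A\cup B$. Two subgraphs $H_1,H_2$ are $n$-close if they are disjoint and there exist $n$ pairwise disjoint $H_1-H_2$ paths of length at most 2. A $\theta$-graph consists of two vertices $u,v$ and three pairwise internally disjoint $u-v$ paths (its legs). A $\theta(k,i)$-necklace is a connected subcubic graph consisting of $k$ disjoint $\theta$-graphs $\Theta_1,\dots,\Theta_k$ and $k$ disjoint paths $P_1,\dots,P_k$ such that $\Theta_j$ has legs $L_{j,1},L_{j,2},L_{j,3}$ where $L_{j,3}$ has length $i$; $P_j$ is an $L_{j,2}-L_{j+1,1}$ path for $j<k$ and $P_k$ is an $L_{k,2}-L_{1,1}$ path; and no interior vertex of any $P_j$ lies in any $\Theta_{j'}$. -}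

module Defs where

open import Data.Nat using (ℕ; zero; suc; _≤_; _<?_)
open import Data.Fin using (Fin; zero; suc; toℕ; fromℕ<)
open import Data.List using (List; []; _∷_; length)
open import Data.List.NonEmpty using (List⁺; toList; head; last)
open import Data.List.Membership.Propositional using (_∈_)
open import Data.List.Relation.Unary.Linked using (Linked)
open import Data.List.Relation.Unary.Unique.Propositional using (Unique)
open import Data.Product using (Σ; ∃; ∃-syntax; _×_; _,_)
open import Data.Sum using (_⊎_)
open import Data.Empty using (⊥)
open import Relation.Nullary using (¬_; yes; no)
open import Relation.Binary.PropositionalEquality using (_≡_; _≢_)

record Graph (n : ℕ) : Set₁ where
  field
    Adj    : Fin n → Fin n → Set
    sym    : ∀ {x y} → Adj x y → Adj y x
    irrefl : ∀ {x} → ¬ Adj x x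
open Graph public

VSet : ℕ → Set₁
VSet n = Fin n → Set

Disjoint : ∀ {n} → VSet n → VSet n → Set
Disjoint A B = ∀ x → A x → B x → ⊥

record Path {n : ℕ} (R : Fin n → Fin n → Set) : Set where
  field
    verts  : List⁺ (Fin n)
    unique : Unique (toList verts)
    linked : Linked R (toList verts)
open Path public

module _ {n : ℕ} {R : Fin n → Fin n → Set} where

  start end : Path R → Fin n
  start P = head (verts P)
  end   P = last (verts P)

  -- length = number of edges
  len : Path R → ℕ
  len P = length (Data.List.NonEmpty.tail (verts P))

  VP : Path R → VSet n
  VP P x = x ∈ toList (verts P)

  Inner : Path R → VSet n
  Inner P x = x ∈ toList (verts P) × x ≢ start P × x ≢ end P

  IsABPath : VSet n → VSet n → Path R → Set
  IsABPath A B P =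
    ((A (start P) × B (end P)) ⊎ (B (start P) × A (end P))) ×
    (∀ x → Inner P x → ¬ (A x ⊎ B x))

data Consec {n : ℕ} (x y : Fin n) : List (Fin n) → Set where
  here  : ∀ {rest} → Consec x y (x ∷ y ∷ rest)
  there : ∀ {a rest} → Consec x y rest → Consec x y (a ∷ rest)

EP : ∀ {n} {R : Fin n → Fin n → Set} → Path R → Fin n → Fin n → Set
EP P x y = Consec x y (toList (verts P)) ⊎ Consec y x (toList (verts P))

-- Cycles in G: at least three pairwise distinct vertices v₀ … vₘ,
-- consecutive ones adjacent and vₘ adjacent to v₀.

record Cycle {n : ℕ} (G : Graph n) : Set where
  field
    cpath  : Path (Adj G)
    long   : 2 ≤ len cpath
    closes : Adj G (end cpath) (start cpath)
open Cycle public

VC : ∀ {n} {G : Graph n} → Cycle G → VSet n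
VC C = VP (cpath C)

Close : ∀ {n} (G : Graph n) → ℕ → VSet n → VSet n → Set
Close {n} G m A B =
  Disjoint A B ×
  Σ (Fin m → Path (Adj G)) λ Q →
    (∀ t → IsABPath A B (Q t) × len (Q t) ≤ 2) ×
    (∀ s t → s ≢ t → Disjoint (VP (Q s)) (VP (Q t)))

record Theta {n : ℕ} (G : Graph n) : Set where
  field
    u v  : Fin n
    u≢v  : u ≢ v
    leg  : Fin 3 → Path (Adj G)
    leg-start : ∀ t → start (leg t) ≡ u
    leg-end   : ∀ t → end (leg t) ≡ v
    leg-distinct : ∀ s t → s ≢ t → verts (leg s) ≢ verts (leg t)
    leg-intdisj  : ∀ s t → s ≢ t → Disjoint (Inner (leg s)) (Inner (leg t))
open Theta public

VΘ : ∀ {n} {G : Graph n} → Theta G → VSet n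
VΘ Θ x = ∃[ t ] VP (leg Θ t) x

EΘ : ∀ {n} {G : Graph n} → Theta G → Fin n → Fin n → Set
EΘ Θ x y = ∃[ t ] EP (leg Θ t) x y

L₁ L₂ L₃ : ∀ {n} {G : Graph n} → Theta G → Path (Adj G)
L₁ Θ = leg Θ zero
L₂ Θ = leg Θ (suc zero)
L₃ Θ = leg Θ (suc (suc zero))

cyc : ∀ {k} → Fin k → Fin k
cyc {suc m} j with suc (toℕ j) <? suc m
... | yes p = fromℕ< p
... | no _  = zero

record Necklace {n : ℕ} (G : Graph n) (k i : ℕ) : Set where
  field
    Θ : Fin k → Theta G
    P : Fin k → Path (Adj G)
    Θ-disjoint : ∀ j j' → j ≢ j' → Disjoint (VΘ (Θ j)) (VΘ (Θ j'))
    P-disjoint : ∀ j j' → j ≢ j' → Disjoint (VP (P j)) (VP (P j'))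
    L₃-length  : ∀ j → len (L₃ (Θ j)) ≡ i
    P-link     : ∀ j → IsABPath (VP (L₂ (Θ j))) (VP (L₁ (Θ (cyc j)))) (P j)
    P-inner    : ∀ j j' → Disjoint (Inner (P j)) (VΘ (Θ j'))

  VN : VSet n
  VN x = (∃[ j ] VΘ (Θ j) x) ⊎ (∃[ j ] VP (P j) x)

  EN : Fin n → Fin n → Set
  EN x y = (∃[ j ] EΘ (Θ j) x y) ⊎ (∃[ j ] EP (P j) x y)

  field
    connected : ∀ x y → VN x → VN y →
                Σ (Path EN) λ Q → start Q ≡ x × end Q ≡ y
    subcubic  : ∀ x (f : Fin 4 → Fin n) →
                (∀ s t → f s ≡ f t → s ≡ t) → (∀ t → EN x (f t)) → ⊥

module Submission where

-- Every short C–P path is a rung: an edge, or a path of length 2, from a foot on C to a top on P;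
-- the 18k² rungs are pairwise disjoint, so 9k² of them have the same length.  Listing these by
-- their feet along C, the Erdős–Szekeres theorem gives 3k of them whose tops are monotone along P,
-- and after reversing P both feet and tops increase: a ladder.  Rungs 3j, 3j+1, 3j+2 together with
-- the segments of C and P between them form a θ-graph whose third leg is the middle rung, and
-- consecutive θ-graphs are linked along C.  Every vertex of this necklace has at most three
-- neighbours in C, P and the chosen rungs, so the necklace is subcubic.

open import Data.Nat
open import Data.Nat.Properties
open import Data.Nat.Solver using (module +-*-Solver)
open import Data.Fin using (Fin; zero; suc; toℕ; fromℕ<)
import Data.Fin.Properties as Fin
open import Data.List using (List; []; _∷_; _++_; length; map; take; filter; upTo; applyUpTo; applyDownFrom)
import Data.List as List
import Data.List.Properties as List
open import Data.List.NonEmpty using (_∷_; toList)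
import Data.List.NonEmpty as List⁺
open import Data.List.Membership.Propositional using (_∈_)
import Data.List.Membership.DecPropositional as DecMembership
open import Data.List.Membership.Propositional.Properties
  using (∈-++⁻; ∈-++⁺ˡ; ∈-++⁺ʳ; ∈-applyUpTo⁻; ∈-applyDownFrom⁻; ∈-filter⁺; ∈-upTo⁺)
open import Data.List.Relation.Unary.Any using (Any; here; there; any?)
import Data.List.Relation.Unary.Any as Any
import Data.List.Relation.Unary.Any.Properties as Any
open import Data.List.Relation.Unary.All using (All; []; _∷_)
import Data.List.Relation.Unary.All as All
import Data.List.Relation.Unary.All.Properties as All
open import Data.List.Relation.Unary.AllPairs using (AllPairs; []; _∷_)
import Data.List.Relation.Unary.AllPairs as AllPairs
import Data.List.Relation.Unary.AllPairs.Properties as AllPairs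
open import Data.List.Relation.Unary.Linked using (Linked; []; [-]; _∷_)
import Data.List.Relation.Unary.Linked.Properties as Linked
open import Data.List.Relation.Unary.Unique.Propositional using (Unique)
import Data.List.Relation.Unary.Unique.Propositional.Properties as Unique
open import Data.List.Relation.Binary.Sublist.Propositional
  using (_⊆_; []; _∷_; _∷ʳ_; ⊆-refl; ⊆-trans; minimum; lookup)
open import Data.List.Relation.Binary.Sublist.Propositional.Properties
  using (filter-⊆; All-resp-⊆) renaming (map⁺ to ⊆-map⁺)
open import Data.List.Relation.Binary.Sublist.Heterogeneous.Properties using (take-Sublist)
open import Data.Product using (Σ; ∃; ∃₂; ∃-syntax; _×_; _,_; proj₁; proj₂)
open import Data.Sum using (_⊎_; inj₁; inj₂; [_,_]′)
import Data.Sum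
open import Data.Empty using (⊥; ⊥-elim)
open import Function using (_∘_; _∘′_)
open import Relation.Nullary using (¬_; Dec; yes; no; ¬?)
open import Relation.Nullary.Decidable using (_×-dec_)
open import Relation.Binary using (tri<; tri≈; tri>)
open import Relation.Binary.PropositionalEquality
open import Relation.Binary.Construct.Closure.ReflexiveTransitive using (Star; ε; _◅_; _◅◅_; reverse)
open import Defs renaming (sym to Adj-sym)

module _ {A : Set} where

  lastOf : A → List A → A
  lastOf x [] = x
  lastOf _ (y ∷ ys) = lastOf y ys

  last≡lastOf : ∀ x xs → List⁺.last (x ∷ xs) ≡ lastOf x xs
  last≡lastOf x [] = refl
  last≡lastOf x (y ∷ ys) with List.initLast ys | last≡lastOf y ys
  ... | List.[]       | ih = ih
  ... | _ List.∷ʳ′ _  | ih = ih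

  lastOf-∈ : ∀ (x : A) xs → lastOf x xs ∈ x ∷ xs
  lastOf-∈ x [] = here refl
  lastOf-∈ x (y ∷ ys) = there (lastOf-∈ y ys)

  lastOf-++ : ∀ x xs {y} ys → lastOf x xs ≡ y → lastOf x (xs ++ ys) ≡ lastOf y ys
  lastOf-++ x [] ys refl = refl
  lastOf-++ x (z ∷ xs) ys eq = lastOf-++ z xs ys eq

  lastOf-++-∷ : ∀ x xs y ys → lastOf x (xs ++ y ∷ ys) ≡ lastOf y ys
  lastOf-++-∷ x [] y ys = refl
  lastOf-++-∷ x (z ∷ xs) y ys = lastOf-++-∷ z xs y ys

  Linked-++-∷ : ∀ {R : A → A → Set} x xs y ys → R (lastOf x xs) y →
                Linked R (x ∷ xs) → Linked R (y ∷ ys) → Linked R (x ∷ xs ++ y ∷ ys)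
  Linked-++-∷ x [] y ys r _ l = r ∷ l
  Linked-++-∷ x (z ∷ xs) y ys r (r′ ∷ l) l′ = r′ ∷ Linked-++-∷ z xs y ys r l l′

  lastOf-applyUpTo : ∀ (g : ℕ → A) l → lastOf (g 0) (applyUpTo (g ∘ suc) l) ≡ g l
  lastOf-applyUpTo g zero = refl
  lastOf-applyUpTo g (suc l) = lastOf-applyUpTo (g ∘ suc) l

  lastOf-applyDownFrom : ∀ (g : ℕ → A) l → lastOf (g l) (applyDownFrom g l) ≡ g 0
  lastOf-applyDownFrom g zero = refl
  lastOf-applyDownFrom g (suc l) = lastOf-applyDownFrom g l

  at : A → List A → ℕ → A
  at d [] i = d
  at d (x ∷ xs) zero = x
  at d (x ∷ xs) (suc i) = at d xs i

  module _ (d : A) where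

    at-∈ : ∀ xs {i} → i < length xs → at d xs i ∈ xs
    at-∈ (x ∷ xs) {zero} _ = here refl
    at-∈ (x ∷ xs) {suc i} (s≤s i<) = there (at-∈ xs i<)

    ∈⇒at : ∀ {xs y} → y ∈ xs → ∃ λ i → i < length xs × at d xs i ≡ y
    ∈⇒at (here refl) = zero , s≤s z≤n , refl
    ∈⇒at (there y∈) with ∈⇒at y∈
    ... | i , i< , eq = suc i , s≤s i< , eq

    at-AllPairs : ∀ {R : A → A → Set} {xs} → AllPairs R xs →
                  ∀ {i j} → i < j → j < length xs → R (at d xs i) (at d xs j)
    at-AllPairs {xs = x ∷ xs} (rs ∷ _) {zero} {suc j} _ (s≤s j<) = All.lookup rs (at-∈ xs j<)
    at-AllPairs {xs = x ∷ xs} (_ ∷ ps) {suc i} {suc j} (s≤s i<j) (s≤s j<) = at-AllPairs ps i<j j<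

    at-Linked : ∀ {R : A → A → Set} {xs} → Linked R xs →
                ∀ {i} → suc i < length xs → R (at d xs i) (at d xs (suc i))
    at-Linked (r ∷ _) {zero} _ = r
    at-Linked (_ ∷ l) {suc i} (s≤s i<) = at-Linked l i<
    at-Linked [-] (s≤s ())

    lastOf≡at : ∀ x xs → lastOf x xs ≡ at d (x ∷ xs) (length xs)
    lastOf≡at x [] = refl
    lastOf≡at x (y ∷ ys) = lastOf≡at y ys

    at-injective : ∀ {xs} → Unique xs → ∀ {i j} → i < length xs → j < length xs →
                   at d xs i ≡ at d xs j → i ≡ j
    at-injective (_ ∷ _) {zero} {zero} _ _ _ = refl
    at-injective {x ∷ xs} (x∉ ∷ _) {zero} {suc j} _ (s≤s j<) eq = ⊥-elim (All.lookup x∉ (at-∈ xs j<) eq)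
    at-injective {x ∷ xs} (x∉ ∷ _) {suc i} {zero} (s≤s i<) _ eq = ⊥-elim (All.lookup x∉ (at-∈ xs i<) (sym eq))
    at-injective (_ ∷ u) {suc i} {suc j} (s≤s i<) (s≤s j<) eq = cong suc (at-injective u i< j< eq)

module _ {n : ℕ} where

  Consec-applyUpTo : ∀ (g : ℕ → Fin n) l {v w} → Consec v w (applyUpTo g l) →
                     ∃ λ i → suc i < l × v ≡ g i × w ≡ g (suc i)
  Consec-applyUpTo g (suc (suc l)) here = 0 , s≤s (s≤s z≤n) , refl , refl
  Consec-applyUpTo g (suc l) (there c) with Consec-applyUpTo (g ∘ suc) l c
  ... | i , i<l , refl , refl = suc i , s≤s i<l , refl , refl

  Consec-applyDownFrom : ∀ (g : ℕ → Fin n) l {v w} → Consec v w (applyDownFrom g l) →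
                         ∃ λ i → suc i < l × v ≡ g (suc i) × w ≡ g i
  Consec-applyDownFrom g (suc (suc l)) here = l , ≤-refl , refl , refl
  Consec-applyDownFrom g (suc l) (there c) with Consec-applyDownFrom g l c
  ... | i , i<l , refl , refl = i , m<n⇒m<1+n i<l , refl , refl

  Consec-++-∷ : ∀ (x : Fin n) xs y ys {v w} → Consec v w (x ∷ xs ++ y ∷ ys) →
                Consec v w (x ∷ xs) ⊎ Consec v w (y ∷ ys) ⊎ (v ≡ lastOf x xs × w ≡ y)
  Consec-++-∷ x [] y ys here = inj₂ (inj₂ (refl , refl))
  Consec-++-∷ x [] y ys (there c) = inj₂ (inj₁ c)
  Consec-++-∷ x (z ∷ xs) y ys here = inj₁ here
  Consec-++-∷ x (z ∷ xs) y ys (there c) with Consec-++-∷ z xs y ys c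
  ... | inj₁ c′ = inj₁ (there c′)
  ... | inj₂ c′ = inj₂ c′

  module Glue (x : Fin n) (xs : List (Fin n)) {y : Fin n} (ys : List (Fin n)) (meet : lastOf x xs ≡ y) where

    ∈⁻ : ∀ {v} → v ∈ x ∷ xs ++ ys → v ∈ x ∷ xs ⊎ v ∈ y ∷ ys
    ∈⁻ v∈ = Data.Sum.map₂ there (∈-++⁻ (x ∷ xs) v∈)

    ∈⁺ʳ : ∀ {v} → v ∈ y ∷ ys → v ∈ x ∷ xs ++ ys
    ∈⁺ʳ (here refl) = ∈-++⁺ˡ (subst (_∈ x ∷ xs) meet (lastOf-∈ x xs))
    ∈⁺ʳ (there v∈) = there (∈-++⁺ʳ xs v∈)

    last : lastOf x (xs ++ ys) ≡ lastOf y ys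
    last = lastOf-++ x xs ys meet

    Consec⁻ : ∀ {v w} → Consec v w (x ∷ xs ++ ys) → Consec v w (x ∷ xs) ⊎ Consec v w (y ∷ ys)
    Consec⁻ = go x xs meet
      where
      go : ∀ x xs → lastOf x xs ≡ y → ∀ {v w} → Consec v w (x ∷ xs ++ ys) →
           Consec v w (x ∷ xs) ⊎ Consec v w (y ∷ ys)
      go x [] refl c = inj₂ c
      go x (z ∷ xs) eq here = inj₁ here
      go x (z ∷ xs) eq (there c) with go z xs eq c
      ... | inj₁ c′ = inj₁ (there c′)
      ... | inj₂ c′ = inj₂ c′

    Linked⁺ : ∀ {R : Fin n → Fin n → Set} → Linked R (x ∷ xs) → Linked R (y ∷ ys) → Linked R (x ∷ xs ++ ys)
    Linked⁺ = go x xs meet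
      where
      go : ∀ {R : Fin n → Fin n → Set} x xs → lastOf x xs ≡ y →
           Linked R (x ∷ xs) → Linked R (y ∷ ys) → Linked R (x ∷ xs ++ ys)
      go x [] refl _ l = l
      go x (z ∷ xs) eq (r ∷ l) l′ = r ∷ go z xs eq l l′

    Unique⁺ : Unique (x ∷ xs) → Unique (y ∷ ys) → (∀ {v} → v ∈ x ∷ xs → v ∈ ys → ⊥) →
             Unique (x ∷ xs ++ ys)
    Unique⁺ u (_ ∷ u′) disj = Unique.++⁺ {xs = x ∷ xs} u u′ (λ (p , q) → disj p q)

  module Ascent (f : ℕ → Fin n) {a e : ℕ} (a≤e : a ≤ e) where

    tail : List (Fin n)
    tail = applyUpTo (λ i → f (suc i + a)) (e ∸ a)

    private
      shift : ∀ {i} → i < suc (e ∸ a) → i + a ≤ e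
      shift {i} i< = subst (i + a ≤_) (m∸n+n≡m a≤e) (+-monoˡ-≤ a (≤-pred i<))

    ∈⁻ : ∀ {y} → y ∈ f a ∷ tail → ∃ λ x → a ≤ x × x ≤ e × y ≡ f x
    ∈⁻ y∈ with ∈-applyUpTo⁻ (λ i → f (i + a)) y∈
    ... | i , i< , refl = i + a , m≤n+m a i , shift i< , refl

    tail-∈⁻ : ∀ {y} → y ∈ tail → ∃ λ x → a < x × x ≤ e × y ≡ f x
    tail-∈⁻ y∈ with ∈-applyUpTo⁻ (λ i → f (suc i + a)) y∈
    ... | i , i< , refl = suc i + a , s≤s (m≤n+m a i) , shift (s≤s i<) , refl

    last : lastOf (f a) tail ≡ f e
    last = trans (lastOf-applyUpTo (λ i → f (i + a)) (e ∸ a)) (cong f (m∸n+n≡m a≤e))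

    Unique⁺ : (∀ {x y} → a ≤ x → x < y → y ≤ e → f x ≢ f y) → Unique (f a ∷ tail)
    Unique⁺ inj = Unique.applyUpTo⁺₁ (λ i → f (i + a)) (suc (e ∸ a))
                   (λ i<j j< → inj (m≤n+m a _) (+-monoˡ-< a i<j) (shift j<))

    Linked⁺ : ∀ {R : Fin n → Fin n → Set} → (∀ {x} → a ≤ x → x < e → R (f x) (f (suc x))) →
             Linked R (f a ∷ tail)
    Linked⁺ step = Linked.applyUpTo⁺₁ (λ i → f (i + a)) (suc (e ∸ a)) (λ i< → step (m≤n+m a _) (shift i<))

    Consec⁻ : ∀ {y z} → Consec y z (f a ∷ tail) → ∃ λ x → a ≤ x × x < e × y ≡ f x × z ≡ f (suc x)
    Consec⁻ c with Consec-applyUpTo (λ i → f (i + a)) (suc (e ∸ a)) c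
    ... | i , i< , refl , refl = i + a , m≤n+m a i , shift i< , refl , refl

  module Descent (f : ℕ → Fin n) {a e : ℕ} (a≤e : a ≤ e) where

    tail : List (Fin n)
    tail = applyDownFrom (λ i → f (i + a)) (e ∸ a)

    private
      g : ℕ → Fin n
      g i = f (i + a)

      shift : ∀ {i} → i < suc (e ∸ a) → i + a ≤ e
      shift {i} i< = subst (i + a ≤_) (m∸n+n≡m a≤e) (+-monoˡ-≤ a (≤-pred i<))

      unfold : applyDownFrom g (suc (e ∸ a)) ≡ f e ∷ tail
      unfold = cong (_∷ tail) (cong f (m∸n+n≡m a≤e))

    ∈⁻ : ∀ {y} → y ∈ f e ∷ tail → ∃ λ x → a ≤ x × x ≤ e × y ≡ f x
    ∈⁻ {y} y∈ with ∈-applyDownFrom⁻ g (subst (y ∈_) (sym unfold) y∈)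
    ... | i , i< , refl = i + a , m≤n+m a i , shift i< , refl

    tail-∈⁻ : ∀ {y} → y ∈ tail → ∃ λ x → a ≤ x × x < e × y ≡ f x
    tail-∈⁻ y∈ with ∈-applyDownFrom⁻ g y∈
    ... | i , i< , refl = i + a , m≤n+m a i , shift (s≤s i<) , refl

    last : lastOf (f e) tail ≡ f a
    last = subst (λ h → lastOf h tail ≡ f a) (cong f (m∸n+n≡m a≤e)) (lastOf-applyDownFrom g (e ∸ a))

    Unique⁺ : (∀ {x y} → a ≤ x → x < y → y ≤ e → f x ≢ f y) → Unique (f e ∷ tail)
    Unique⁺ inj = subst Unique unfold (Unique.applyDownFrom⁺₁ g (suc (e ∸ a))
                   (λ j<i i< → inj (m≤n+m a _) (+-monoˡ-< a j<i) (shift i<) ∘ sym))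

    Linked⁺ : ∀ {R : Fin n → Fin n → Set} → (∀ {x} → a ≤ x → x < e → R (f (suc x)) (f x)) →
             Linked R (f e ∷ tail)
    Linked⁺ step = subst (Linked _) unfold
                    (Linked.applyDownFrom⁺₁ g (suc (e ∸ a)) (λ i< → step (m≤n+m a _) (shift i<)))

    Consec⁻ : ∀ {y z} → Consec y z (f e ∷ tail) → ∃ λ x → a ≤ x × x < e × y ≡ f (suc x) × z ≡ f x
    Consec⁻ c with Consec-applyDownFrom g (suc (e ∸ a)) (subst (Consec _ _) (sym unfold) c)
    ... | i , i< , refl , refl = i + a , m≤n+m a i , shift i< , refl , refl

module _ {A : Set} where

  AllPairs-resp-⊆ : ∀ {R : A → A → Set} {xs ys} → xs ⊆ ys → AllPairs R ys → AllPairs R xs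
  AllPairs-resp-⊆ [] [] = []
  AllPairs-resp-⊆ (_ ∷ʳ sub) (_ ∷ ps) = AllPairs-resp-⊆ sub ps
  AllPairs-resp-⊆ (refl ∷ sub) (rs ∷ ps) = All-resp-⊆ sub rs ∷ AllPairs-resp-⊆ sub ps

  AllPairs-zipWith-All : ∀ {P : A → Set} {R S T : A → A → Set} →
                         (∀ {x y} → P x → P y → R x y → S x y → T x y) →
                         ∀ {xs} → All P xs → AllPairs R xs → AllPairs S xs → AllPairs T xs
  AllPairs-zipWith-All f [] [] [] = []
  AllPairs-zipWith-All f (px ∷ pxs) (rs ∷ rss) (ss ∷ sss) =
    go pxs rs ss ∷ AllPairs-zipWith-All f pxs rss sss
    where
    go : ∀ {ys} → All _ ys → All _ ys → All _ ys → All _ ys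
    go [] [] [] = []
    go (py ∷ pys) (r ∷ rs′) (s ∷ ss′) = f px py r s ∷ go pys rs′ ss′

  ∈-injection⇒≤length : ∀ {m} (zs : List A) (g : Fin m → A) → (∀ s t → g s ≡ g t → s ≡ t) →
                        (∀ t → g t ∈ zs) → m ≤ length zs
  ∈-injection⇒≤length {m} zs g inj g∈ with m ≤? length zs
  ... | yes m≤ = m≤
  ... | no m≰ with Fin.pigeonhole (≰⇒> m≰) (λ t → Any.index (g∈ t))
  ... | s , t , s<t , same = ⊥-elim (Fin.<⇒≢ s<t (inj s t (trans (Any.lookup-index (g∈ s))
                              (trans (cong (List.lookup zs) same) (sym (Any.lookup-index (g∈ t)))))))

  take-length : ∀ m (xs : List A) → m ≤ length xs → length (take m xs) ≡ m
  take-length m xs m≤ = trans (List.length-take m xs) (m≤n⇒m⊓n≡m m≤)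

  length-filter-¬ : ∀ {P : A → Set} (P? : ∀ x → Dec (P x)) xs →
                    length (filter P? xs) + length (filter (λ x → ¬? (P? x)) xs) ≡ length xs
  length-filter-¬ P? [] = refl
  length-filter-¬ P? (x ∷ xs) with P? x
  ... | yes _ = cong suc (length-filter-¬ P? xs)
  ... | no _ = trans (+-suc _ _) (cong suc (length-filter-¬ P? xs))

  pigeonhole-labels : ∀ (label : A → ℕ) p s (zs : List A) → All (λ z → label z < p) zs → p * s < length zs →
                      ∃₂ λ v ws → ws ⊆ zs × s < length ws × All (λ w → label w ≡ v) ws
  pigeonhole-labels label zero s [] _ ()
  pigeonhole-labels label zero s (z ∷ zs) (() ∷ _) _
  pigeonhole-labels label (suc p) s zs bounded long with s <? length (filter (λ z → label z ≟ p) zs)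
  ... | yes many = p , _ , filter-⊆ _ zs , many , All.all-filter _ zs
  ... | no few with pigeonhole-labels label p s rest rest-bounded rest-long
    where
    rest : List A
    rest = filter (λ z → ¬? (label z ≟ p)) zs
    rest-bounded : All (λ z → label z < p) rest
    rest-bounded = All.zipWith (λ (lt , ne) → ≤∧≢⇒< (≤-pred lt) ne)
                     (All-resp-⊆ (filter-⊆ _ zs) bounded , All.all-filter _ zs)
    rest-long : p * s < length rest
    rest-long = +-cancelˡ-< s (p * s) (length rest)
      (<-≤-trans long (≤-trans (≤-reflexive (sym (length-filter-¬ (λ z → label z ≟ p) zs)))
                                (+-monoˡ-≤ (length rest) (≮⇒≥ few))))
  ... | v , ws , sub , many , same = v , ws , ⊆-trans sub (filter-⊆ _ zs) , many , same

module ErdősSzekeres (b : ℕ → ℕ) where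

  Rising Falling : ℕ → ℕ → Set
  Rising x y = b x < b y
  Falling x y = b y < b x

  private
    -- an element together with a longest rising chain among the elements after it
    Labelled : Set
    Labelled = ℕ × List ℕ

    chain : Labelled → List ℕ
    chain (x , c) = x ∷ c

    longer : List ℕ → List ℕ → List ℕ
    longer u v with length v ≤? length u
    ... | yes _ = u
    ... | no _ = v

    longer-≡ : ∀ u v → longer u v ≡ u ⊎ longer u v ≡ v
    longer-≡ u v with length v ≤? length u
    ... | yes _ = inj₁ refl
    ... | no _ = inj₂ refl

    longer-≥ : ∀ u v → length u ≤ length (longer u v) × length v ≤ length (longer u v)
    longer-≥ u v with length v ≤? length u
    ... | yes v≤u = ≤-refl , v≤u
    ... | no v≰u = <⇒≤ (≰⇒> v≰u) , ≤-refl

    longestAbove : ℕ → List Labelled → List ℕ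
    longestAbove x [] = []
    longestAbove x (e ∷ es) with b x <? b (proj₁ e)
    ... | yes _ = longer (chain e) (longestAbove x es)
    ... | no _ = longestAbove x es

    label : List ℕ → List Labelled
    label [] = []
    label (x ∷ xs) = (x , longestAbove x (label xs)) ∷ label xs

    map-proj₁-label : ∀ xs → map proj₁ (label xs) ≡ xs
    map-proj₁-label [] = refl
    map-proj₁-label (x ∷ xs) = cong (x ∷_) (map-proj₁-label xs)

    RisingChainIn : List ℕ → Labelled → Set
    RisingChainIn ys e = chain e ⊆ ys × Linked Rising (chain e)

    longestAbove-chain : ∀ x ys es → All (RisingChainIn ys) es →
                         longestAbove x es ⊆ ys × Linked Rising (x ∷ longestAbove x es)
    longestAbove-chain x ys [] [] = minimum ys , [-]
    longestAbove-chain x ys (e ∷ es) (ok ∷ oks) with b x <? b (proj₁ e)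
    ... | no _ = longestAbove-chain x ys es oks
    ... | yes x<e with longer-≡ (chain e) (longestAbove x es)
    ...   | inj₁ eq rewrite eq = proj₁ ok , x<e ∷ proj₂ ok
    ...   | inj₂ eq rewrite eq = longestAbove-chain x ys es oks

    label-chain : ∀ xs → All (RisingChainIn xs) (label xs)
    label-chain [] = []
    label-chain (x ∷ xs) with longestAbove-chain x xs (label xs) (label-chain xs)
    ... | sub , rising = (refl ∷ sub , rising) ∷ All.map (λ (sub′ , r) → x ∷ʳ sub′ , r) (label-chain xs)

    longestAbove-≥ : ∀ x es → All (λ e → b x < b (proj₁ e) → suc (length (proj₂ e)) ≤ length (longestAbove x es)) es
    longestAbove-≥ x [] = []
    longestAbove-≥ x (e ∷ es) with b x <? b (proj₁ e)
    ... | yes _ = (λ _ → proj₁ (longer-≥ (chain e) (longestAbove x es))) ∷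
                  All.map (λ h lt → ≤-trans (h lt) (proj₂ (longer-≥ (chain e) (longestAbove x es)))) (longestAbove-≥ x es)
    ... | no x≮e = (λ x<e → ⊥-elim (x≮e x<e)) ∷ longestAbove-≥ x es

    Dominates : Labelled → Labelled → Set
    Dominates e e′ = b (proj₁ e) < b (proj₁ e′) → length (proj₂ e′) < length (proj₂ e)

    label-dominates : ∀ xs → AllPairs Dominates (label xs)
    label-dominates [] = []
    label-dominates (x ∷ xs) = longestAbove-≥ x (label xs) ∷ label-dominates xs

  erdős-szekeres : ∀ q xs → AllPairs (λ x y → b x ≢ b y) xs → suc (q * q) ≤ length xs →
                   ∃ λ ys → ys ⊆ xs × length ys ≡ suc q × (AllPairs Rising ys ⊎ AllPairs Falling ys)
  erdős-szekeres q xs distinct long with any? (λ e → q ≤? length (proj₂ e)) (label xs)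
  ... | yes long-chain = rising long-chain (label-chain xs)
    where
    rising : ∀ {es} → Any (λ e → q ≤ length (proj₂ e)) es → All (RisingChainIn xs) es →
             ∃ λ ys → ys ⊆ xs × length ys ≡ suc q × (AllPairs Rising ys ⊎ AllPairs Falling ys)
    rising {e ∷ _} (here q≤) ((sub , r) ∷ _) =
      take (suc q) (chain e) , ⊆-trans (take-Sublist (suc q) ⊆-refl) sub ,
      take-length (suc q) (chain e) (s≤s q≤) ,
      inj₁ (AllPairs.take⁺ (suc q) (Linked.Linked⇒AllPairs <-trans r))
    rising (there any) (_ ∷ oks) = rising any oks
  ... | no no-long-chain with pigeonhole-labels (λ e → length (proj₂ e)) q q (label xs) short long′
    where
    short : All (λ e → length (proj₂ e) < q) (label xs)
    short = All.map ≰⇒> (All.¬Any⇒All¬ (label xs) no-long-chain)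
    long′ : q * q < length (label xs)
    long′ = subst (q * q <_) (sym (trans (sym (List.length-map proj₁ (label xs))) (cong length (map-proj₁-label xs)))) long
  ... | v , ws , sub , many , same-length =
      take (suc q) (map proj₁ ws) ,
      ⊆-trans (take-Sublist (suc q) ⊆-refl) (subst (map proj₁ ws ⊆_) (map-proj₁-label xs) (⊆-map⁺ proj₁ sub)) ,
      take-length (suc q) (map proj₁ ws) (subst (suc q ≤_) (sym (List.length-map proj₁ ws)) many) ,
      inj₂ (AllPairs.take⁺ (suc q) (AllPairs.map⁺ falling))
    where
    distinct′ : AllPairs (λ e e′ → b (proj₁ e) ≢ b (proj₁ e′)) (label xs)
    distinct′ = AllPairs.map⁻ (subst (AllPairs (λ x y → b x ≢ b y)) (sym (map-proj₁-label xs)) distinct)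
    -- equal chain lengths rule out rising pairs, and distinctness rules out ties
    falling : AllPairs (λ e e′ → b (proj₁ e′) < b (proj₁ e)) ws
    falling = AllPairs-zipWith-All {R = Dominates} (λ {e} {e′} → fall {e} {e′}) same-length
                (AllPairs-resp-⊆ sub (label-dominates xs)) (AllPairs-resp-⊆ sub distinct′)
      where
      fall : ∀ {e e′} → length (proj₂ e) ≡ v → length (proj₂ e′) ≡ v → Dominates e e′ →
             b (proj₁ e) ≢ b (proj₁ e′) → b (proj₁ e′) < b (proj₁ e)
      fall {e} {e′} le le′ dom ne with <-cmp (b (proj₁ e′)) (b (proj₁ e))
      ... | tri< lt _ _ = lt
      ... | tri≈ _ eq _ = ⊥-elim (ne (sym eq))
      ... | tri> _ _ gt = ⊥-elim (<⇒≢ (dom gt) (trans le′ (sym le)))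

module _ {n : ℕ} where

  Star-along : ∀ {S : Fin n → Fin n → Set} x xs → (∀ {y z} → Consec y z (x ∷ xs) → S y z) →
               ∀ {y} → y ∈ x ∷ xs → Star S x y
  Star-along x xs edge (here refl) = ε
  Star-along x (x′ ∷ xs) edge (there y∈) = edge here ◅ Star-along x′ xs (edge ∘′ there) y∈

module _ {n : ℕ} {R : Fin n → Fin n → Set} where

  end-∈ : (Q : Path R) → VP Q (end Q)
  end-∈ Q = subst (_∈ toList (verts Q)) (sym (last≡lastOf (List⁺.head (verts Q)) (List⁺.tail (verts Q))))
              (lastOf-∈ (List⁺.head (verts Q)) (List⁺.tail (verts Q)))

  Path-reach : ∀ {S : Fin n → Fin n → Set} (Q : Path R) → (∀ {y z} → Consec y z (toList (verts Q)) → S y z) →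
               ∀ {y} → VP Q y → Star S (start Q) y
  Path-reach Q edge = Star-along (List⁺.head (verts Q)) (List⁺.tail (verts Q)) edge

  private
    open DecMembership (Fin._≟_ {n}) using (_∈?_)

    suffix : ∀ x xs {y} → y ∈ x ∷ xs → Unique (x ∷ xs) → Linked R (x ∷ xs) →
             Σ (List (Fin n)) λ ys → Unique (y ∷ ys) × Linked R (y ∷ ys) × lastOf y ys ≡ lastOf x xs
    suffix x xs (here refl) u l = xs , u , l , refl
    suffix x (x′ ∷ xs) (there y∈) (_ ∷ u) (_ ∷ l) = suffix x′ xs y∈ u l

    -- if the first vertex recurs in the shortened rest of the walk, restart from that recurrence
    shortcut : ∀ x xs → Linked R (x ∷ xs) →
               Σ (List (Fin n)) λ ys → Unique (x ∷ ys) × Linked R (x ∷ ys) × lastOf x ys ≡ lastOf x xs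
    shortcut x [] _ = [] , [] ∷ [] , [-] , refl
    shortcut x (x′ ∷ xs) (r ∷ l) with shortcut x′ xs l
    ... | ys , u , l′ , eq with x ∈? (x′ ∷ ys)
    ...   | yes x∈ = let (zs , u″ , l″ , eq′) = suffix x′ ys x∈ u l′ in zs , u″ , l″ , trans eq′ eq
    ...   | no x∉ = x′ ∷ ys , All.tabulate (λ {y} y∈ x≡y → x∉ (subst (_∈ x′ ∷ ys) (sym x≡y) y∈)) ∷ u , r ∷ l′ , eq

    Star⇒walk : ∀ {x y} → Star R x y → Σ (List (Fin n)) λ xs → Linked R (x ∷ xs) × lastOf x xs ≡ y
    Star⇒walk ε = [] , [-] , refl
    Star⇒walk (r ◅ s) with Star⇒walk s
    ... | xs , l , eq = _ ∷ xs , r ∷ l , eq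

  Star⇒Path : ∀ {x y} → Star R x y → Σ (Path R) λ Q → start Q ≡ x × end Q ≡ y
  Star⇒Path {x} s with Star⇒walk s
  ... | xs , l , eq with shortcut x xs l
  ...   | ys , u , l′ , eq′ = record { verts = x ∷ ys ; unique = u ; linked = l′ } , refl ,
                              trans (last≡lastOf x ys) (trans eq′ eq)

module _ {n : ℕ} {G : Graph n} {K : ℕ} (Θ : Fin (suc K) → Theta G) (P : Fin (suc K) → Path (Adj G)) where

  NecklaceEdge : Fin n → Fin n → Set
  NecklaceEdge x y = (∃[ j ] EΘ (Θ j) x y) ⊎ (∃[ j ] EP (P j) x y)

  NecklaceVertex : Fin n → Set
  NecklaceVertex x = (∃[ j ] VΘ (Θ j) x) ⊎ (∃[ j ] VP (P j) x)

  module _ (P-link : ∀ j → IsABPath (VP (L₂ (Θ j))) (VP (L₁ (Θ (cyc j)))) (P j)) where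

    private
      Reach : Fin n → Fin n → Set
      Reach = Star NecklaceEdge

      edge-sym : ∀ {x y} → NecklaceEdge x y → NecklaceEdge y x
      edge-sym (inj₁ (j , t , inj₁ c)) = inj₁ (j , t , inj₂ c)
      edge-sym (inj₁ (j , t , inj₂ c)) = inj₁ (j , t , inj₁ c)
      edge-sym (inj₂ (j , inj₁ c)) = inj₂ (j , inj₂ c)
      edge-sym (inj₂ (j , inj₂ c)) = inj₂ (j , inj₁ c)

      back : ∀ {x y} → Reach x y → Reach y x
      back = reverse edge-sym

      θ-reach : ∀ j {x} → VΘ (Θ j) x → Reach (u (Θ j)) x
      θ-reach j {x} (t , x∈) = subst (λ w → Reach w x) (leg-start (Θ j) t)
                                 (Path-reach (leg (Θ j) t) (λ c → inj₁ (j , t , inj₁ c)) x∈)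

      P-reach : ∀ j {x} → VP (P j) x → Reach (start (P j)) x
      P-reach j = Path-reach (P j) (λ c → inj₂ (j , inj₁ c))

      P-start-reach : ∀ j → Reach (u (Θ j)) (start (P j))
      P-start-reach j with P-link j
      ... | inj₁ (s∈L₂ , _) , _ = θ-reach j (suc zero , s∈L₂)
      ... | inj₂ (_ , e∈L₂) , _ = θ-reach j (suc zero , e∈L₂) ◅◅ back (P-reach j (end-∈ (P j)))

      next-reach : ∀ j → Reach (u (Θ j)) (u (Θ (cyc j)))
      next-reach j with P-link j
      ... | inj₁ (_ , e∈L₁) , _ = P-start-reach j ◅◅ P-reach j (end-∈ (P j)) ◅◅ back (θ-reach (cyc j) (zero , e∈L₁))
      ... | inj₂ (s∈L₁ , _) , _ = P-start-reach j ◅◅ back (θ-reach (cyc j) (zero , s∈L₁))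

      cyc^ : ℕ → Fin (suc K)
      cyc^ zero = zero
      cyc^ (suc i) = cyc (cyc^ i)

      toℕ-cyc^ : ∀ i → i < suc K → toℕ (cyc^ i) ≡ i
      toℕ-cyc^ zero _ = refl
      toℕ-cyc^ (suc i) i< = step (cyc^ i) (toℕ-cyc^ i (<-trans (n<1+n i) i<))
        where
        step : ∀ j → toℕ j ≡ i → toℕ (cyc j) ≡ suc i
        step j refl with suc (toℕ j) <? suc K
        ... | yes lt = Fin.toℕ-fromℕ< lt
        ... | no ≮ = ⊥-elim (≮ i<)

      cyc^-reach : ∀ i → Reach (u (Θ zero)) (u (Θ (cyc^ i)))
      cyc^-reach zero = ε
      cyc^-reach (suc i) = cyc^-reach i ◅◅ next-reach (cyc^ i)

      u-reach : ∀ j → Reach (u (Θ zero)) (u (Θ j))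
      u-reach j = subst (λ w → Reach (u (Θ zero)) (u (Θ w)))
                    (Fin.toℕ-injective (toℕ-cyc^ (toℕ j) (Fin.toℕ<n j))) (cyc^-reach (toℕ j))

      vertex-reach : ∀ {x} → NecklaceVertex x → Reach (u (Θ zero)) x
      vertex-reach (inj₁ (j , x∈)) = u-reach j ◅◅ θ-reach j x∈
      vertex-reach (inj₂ (j , x∈)) = u-reach j ◅◅ P-start-reach j ◅◅ P-reach j x∈

    necklace-connected : ∀ x y → NecklaceVertex x → NecklaceVertex y →
                         Σ (Path NecklaceEdge) λ Q → start Q ≡ x × end Q ≡ y
    necklace-connected x y x∈ y∈ = Star⇒Path (back (vertex-reach x∈) ◅◅ vertex-reach y∈)

record CycleAndPath {n : ℕ} (G : Graph n) : Set where
  field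
    M : ℕ
    c : ℕ → Fin n
    c-injective : ∀ x y → x < M → y < M → c x ≡ c y → x ≡ y
    c-adjacent : ∀ x → suc x < M → Adj G (c x) (c (suc x))
    c-closes : Adj G (c (M ∸ 1)) (c 0)
    L : ℕ
    p : ℕ → Fin n
    p-injective : ∀ x y → x < L → y < L → p x ≡ p y → x ≡ y
    p-adjacent : ∀ x → suc x < L → Adj G (p x) (p (suc x))
    c≢p : ∀ x y → x < M → y < L → c x ≢ p y

module _ {n : ℕ} {G : Graph n} (F : CycleAndPath G) where
  open CycleAndPath F

  record Rung : Set where
    field
      foot top : ℕ
      foot<M : foot < M
      top<L : top < L
      inner : List (Fin n)
      inner-short : inner ≡ [] ⊎ ∃ λ w → inner ≡ w ∷ []
      inner∉c : ∀ y x → y ∈ inner → x < M → y ≢ c x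
      inner∉p : ∀ y x → y ∈ inner → x < L → y ≢ p x
      linked : Linked (Adj G) (c foot ∷ inner ++ p top ∷ [])

  record Ladder (N d : ℕ) : Set where
    field
      rung : ℕ → Rung
      inner-length : ∀ r → r < N → length (Rung.inner (rung r)) ≡ d
      foot-increasing : ∀ r s → r < s → s < N → Rung.foot (rung r) < Rung.foot (rung s)
      top-increasing : ∀ r s → r < s → s < N → Rung.top (rung r) < Rung.top (rung s)
      inner-disjoint : ∀ r s y → r < N → s < N → y ∈ Rung.inner (rung r) → y ∈ Rung.inner (rung s) → r ≡ s

no-four-in-three-slots : ∀ {X : Set} (Slot : Fin 3 → X → Set) → (∀ t y y′ → Slot t y → Slot t y′ → y ≡ y′) →
                         (f : Fin 4 → X) → (∀ s t → f s ≡ f t → s ≡ t) → (∀ t → ∃ λ s → Slot s (f t)) → ⊥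
no-four-in-three-slots Slot one f f-injective slotted
  with Fin.pigeonhole (s≤s (s≤s (s≤s (s≤s z≤n)))) (λ t → proj₁ (slotted t))
... | s , t , s<t , same = Fin.<⇒≢ s<t (f-injective s t
        (one _ _ _ (proj₂ (slotted s)) (subst (λ i → Slot i (f t)) (sym same) (proj₂ (slotted t)))))

triple-< : ∀ {i j} → i < j → 2 + 3 * i < 3 * j
triple-< {i} i<j = ≤-trans (≤-reflexive (sym (*-suc 3 i))) (*-monoʳ-≤ 3 i<j)

pred< : ∀ {m} → 0 < m → pred m < m
pred< (s≤s z≤n) = ≤-refl

≤-suc-pred : ∀ m → m ≤ suc (pred m)
≤-suc-pred zero = z≤n
≤-suc-pred (suc m) = ≤-refl

module FromLadder {n : ℕ} {G : Graph n} {F : CycleAndPath G} {K d : ℕ} (ladder : Ladder F (3 * suc K) d) where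
  open CycleAndPath F
  open Ladder ladder

  k N : ℕ
  k = suc K
  N = 3 * k

  private
    V : Set
    V = Fin n

  A B : ℕ → ℕ
  A r = Rung.foot (rung r)
  B r = Rung.top (rung r)

  mid : ℕ → List V
  mid r = Rung.inner (rung r)

  A<M : ∀ r → A r < M
  A<M r = Rung.foot<M (rung r)

  B<L : ∀ r → B r < L
  B<L r = Rung.top<L (rung r)

  mid∉c : ∀ r y x → y ∈ mid r → x < M → y ≢ c x
  mid∉c r = Rung.inner∉c (rung r)

  mid∉p : ∀ r y x → y ∈ mid r → x < L → y ≢ p x
  mid∉p r = Rung.inner∉p (rung r)

  A-mono : ∀ r s → r ≤ s → s < N → A r ≤ A s
  A-mono r s r≤s s<N with m≤n⇒m<n∨m≡n r≤s
  ... | inj₁ r<s = <⇒≤ (foot-increasing r s r<s s<N)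
  ... | inj₂ refl = ≤-refl

  A-injective : ∀ r s → r < N → s < N → A r ≡ A s → r ≡ s
  A-injective r s r<N s<N eq with <-cmp r s
  ... | tri< lt _ _ = ⊥-elim (<⇒≢ (foot-increasing r s lt s<N) eq)
  ... | tri≈ _ r≡s _ = r≡s
  ... | tri> _ _ gt = ⊥-elim (<⇒≢ (foot-increasing s r gt r<N) (sym eq))

  B-injective : ∀ r s → r < N → s < N → B r ≡ B s → r ≡ s
  B-injective r s r<N s<N eq with <-cmp r s
  ... | tri< lt _ _ = ⊥-elim (<⇒≢ (top-increasing r s lt s<N) eq)
  ... | tri≈ _ r≡s _ = r≡s
  ... | tri> _ _ gt = ⊥-elim (<⇒≢ (top-increasing s r gt r<N) (sym eq))

  OnCycle OnPath OnRungs : ℕ → ℕ → V → Set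
  OnCycle lo hi y = ∃ λ x → lo ≤ x × x ≤ hi × y ≡ c x
  OnPath lo hi y = ∃ λ x → lo ≤ x × x ≤ hi × y ≡ p x
  OnRungs lo hi y = ∃ λ r → lo ≤ r × r ≤ hi × y ∈ mid r

  Region : ℕ → ℕ → ℕ → ℕ → ℕ → ℕ → V → Set
  Region ca cb ra rb pa pb y = OnCycle ca cb y ⊎ OnRungs ra rb y ⊎ OnPath pa pb y

  Region-mono : ∀ {ca cb ra rb pa pb ca′ cb′ ra′ rb′ pa′ pb′ y} →
                ca′ ≤ ca → cb ≤ cb′ → ra′ ≤ ra → rb ≤ rb′ → pa′ ≤ pa → pb ≤ pb′ →
                Region ca cb ra rb pa pb y → Region ca′ cb′ ra′ rb′ pa′ pb′ y
  Region-mono h h′ _ _ _ _ (inj₁ (x , lo , hi , e)) = inj₁ (x , ≤-trans h lo , ≤-trans hi h′ , e)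
  Region-mono _ _ h h′ _ _ (inj₂ (inj₁ (r , lo , hi , e))) = inj₂ (inj₁ (r , ≤-trans h lo , ≤-trans hi h′ , e))
  Region-mono _ _ _ _ h h′ (inj₂ (inj₂ (x , lo , hi , e))) = inj₂ (inj₂ (x , ≤-trans h lo , ≤-trans hi h′ , e))

  cycle∩path : ∀ {lo hi lo′ hi′ y} → hi < M → hi′ < L → OnCycle lo hi y → OnPath lo′ hi′ y → ⊥
  cycle∩path hi<M hi′<L (x , _ , x≤ , refl) (x′ , _ , x′≤ , eq) = c≢p x x′ (≤-<-trans x≤ hi<M) (≤-<-trans x′≤ hi′<L) eq

  cycle∩rungs : ∀ {lo hi lo′ hi′ y} → hi < M → OnCycle lo hi y → OnRungs lo′ hi′ y → ⊥
  cycle∩rungs hi<M (x , _ , x≤ , refl) (r , _ , _ , y∈) = mid∉c r _ x y∈ (≤-<-trans x≤ hi<M) refl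

  path∩rungs : ∀ {lo hi lo′ hi′ y} → hi < L → OnPath lo hi y → OnRungs lo′ hi′ y → ⊥
  path∩rungs hi<L (x , _ , x≤ , refl) (r , _ , _ , y∈) = mid∉p r _ x y∈ (≤-<-trans x≤ hi<L) refl

  cycle∩cycle : ∀ {lo hi lo′ hi′ y} → hi < M → hi′ < M → OnCycle lo hi y → OnCycle lo′ hi′ y →
                ∃ λ x → (lo ≤ x × x ≤ hi) × (lo′ ≤ x × x ≤ hi′) × y ≡ c x
  cycle∩cycle hi<M hi′<M (x , lo≤ , ≤hi , refl) (x′ , lo′≤ , ≤hi′ , eq)
    with c-injective x x′ (≤-<-trans ≤hi hi<M) (≤-<-trans ≤hi′ hi′<M) eq
  ... | refl = x , (lo≤ , ≤hi) , (lo′≤ , ≤hi′) , refl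

  path∩path : ∀ {lo hi lo′ hi′ y} → hi < L → hi′ < L → OnPath lo hi y → OnPath lo′ hi′ y →
              ∃ λ x → (lo ≤ x × x ≤ hi) × (lo′ ≤ x × x ≤ hi′) × y ≡ p x
  path∩path hi<L hi′<L (x , lo≤ , ≤hi , refl) (x′ , lo′≤ , ≤hi′ , eq)
    with p-injective x x′ (≤-<-trans ≤hi hi<L) (≤-<-trans ≤hi′ hi′<L) eq
  ... | refl = x , (lo≤ , ≤hi) , (lo′≤ , ≤hi′) , refl

  rungs∩rungs : ∀ {lo hi lo′ hi′ y} → hi < N → hi′ < N → OnRungs lo hi y → OnRungs lo′ hi′ y →
                ∃ λ r → (lo ≤ r × r ≤ hi) × (lo′ ≤ r × r ≤ hi′)
  rungs∩rungs hi<N hi′<N (r , lo≤ , ≤hi , y∈) (r′ , lo′≤ , ≤hi′ , y∈′)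
    with inner-disjoint r r′ _ (≤-<-trans ≤hi hi<N) (≤-<-trans ≤hi′ hi′<N) y∈ y∈′
  ... | refl = r , (lo≤ , ≤hi) , (lo′≤ , ≤hi′)

  Region∩Region : ∀ {ca cb ra rb pa pb ca′ cb′ ra′ rb′ pa′ pb′ y} →
    cb < M → cb′ < M → rb < N → rb′ < N → pb < L → pb′ < L →
    (∀ r → (ra ≤ r × r ≤ rb) → (ra′ ≤ r × r ≤ rb′) → ⊥) →
    Region ca cb ra rb pa pb y → Region ca′ cb′ ra′ rb′ pa′ pb′ y →
    (∃ λ x → (ca ≤ x × x ≤ cb) × (ca′ ≤ x × x ≤ cb′) × y ≡ c x) ⊎
    (∃ λ x → (pa ≤ x × x ≤ pb) × (pa′ ≤ x × x ≤ pb′) × y ≡ p x)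
  Region∩Region cM cM′ rN rN′ pL pL′ apart = go
    where
    go : _ → _ → _
    go (inj₁ y∈) (inj₁ y∈′) = inj₁ (cycle∩cycle cM cM′ y∈ y∈′)
    go (inj₁ y∈) (inj₂ (inj₁ y∈′)) = ⊥-elim (cycle∩rungs cM y∈ y∈′)
    go (inj₁ y∈) (inj₂ (inj₂ y∈′)) = ⊥-elim (cycle∩path cM pL′ y∈ y∈′)
    go (inj₂ (inj₁ y∈)) (inj₁ y∈′) = ⊥-elim (cycle∩rungs cM′ y∈′ y∈)
    go (inj₂ (inj₁ y∈)) (inj₂ (inj₁ y∈′)) with rungs∩rungs rN rN′ y∈ y∈′
    ... | r , r∈ , r∈′ = ⊥-elim (apart r r∈ r∈′)
    go (inj₂ (inj₁ y∈)) (inj₂ (inj₂ y∈′)) = ⊥-elim (path∩rungs pL′ y∈′ y∈)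
    go (inj₂ (inj₂ y∈)) (inj₁ y∈′) = ⊥-elim (cycle∩path cM′ pL y∈′ y∈)
    go (inj₂ (inj₂ y∈)) (inj₂ (inj₁ y∈′)) = ⊥-elim (path∩rungs pL y∈ y∈′)
    go (inj₂ (inj₂ y∈)) (inj₂ (inj₂ y∈′)) = inj₂ (path∩path pL pL′ y∈ y∈′)

  cycle∩Region : ∀ {lo hi ca cb ra rb pa pb y} → hi < M → cb < M → pb < L →
                 OnCycle lo hi y → Region ca cb ra rb pa pb y →
                 ∃ λ x → (lo ≤ x × x ≤ hi) × (ca ≤ x × x ≤ cb) × y ≡ c x
  cycle∩Region hM cM pL y∈ (inj₁ y∈′) = cycle∩cycle hM cM y∈ y∈′
  cycle∩Region hM cM pL y∈ (inj₂ (inj₁ y∈′)) = ⊥-elim (cycle∩rungs hM y∈ y∈′)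
  cycle∩Region hM cM pL y∈ (inj₂ (inj₂ y∈′)) = ⊥-elim (cycle∩path hM pL y∈ y∈′)

  c∉Region : ∀ {ca cb ra rb pa pb x} → x < M → cb < M → pb < L →
             (x < ca ⊎ cb < x) → ¬ Region ca cb ra rb pa pb (c x)
  c∉Region x<M cM pL outside (inj₁ (x′ , lo , hi , eq)) with c-injective _ x′ x<M (≤-<-trans hi cM) eq
  c∉Region x<M cM pL (inj₁ x<) (inj₁ (x′ , lo , hi , eq)) | refl = <⇒≱ x< lo
  c∉Region x<M cM pL (inj₂ <x) (inj₁ (x′ , lo , hi , eq)) | refl = <⇒≱ <x hi
  c∉Region x<M cM pL _ (inj₂ (inj₁ (r , _ , _ , y∈))) = mid∉c r _ _ y∈ x<M refl
  c∉Region x<M cM pL _ (inj₂ (inj₂ (x′ , _ , hi , eq))) = c≢p _ x′ x<M (≤-<-trans hi pL) eq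

  rung-tail : ℕ → List V
  rung-tail r = mid r ++ p (B r) ∷ []

  rung-tail-∈⁻ : ∀ r {y} → y ∈ rung-tail r → y ∈ mid r ⊎ y ≡ p (B r)
  rung-tail-∈⁻ r y∈ with ∈-++⁻ (mid r) y∈
  ... | inj₁ y∈mid = inj₁ y∈mid
  ... | inj₂ (here eq) = inj₂ eq

  rung-∈⁻ : ∀ r {y} → y ∈ c (A r) ∷ rung-tail r → y ≡ c (A r) ⊎ y ∈ mid r ⊎ y ≡ p (B r)
  rung-∈⁻ r (here eq) = inj₁ eq
  rung-∈⁻ r (there y∈) = inj₂ (rung-tail-∈⁻ r y∈)

  rung-Region : ∀ r {y} → y ∈ c (A r) ∷ rung-tail r → Region (A r) (A r) r r (B r) (B r) y
  rung-Region r y∈ with rung-∈⁻ r y∈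
  ... | inj₁ eq = inj₁ (A r , ≤-refl , ≤-refl , eq)
  ... | inj₂ (inj₁ y∈mid) = inj₂ (inj₁ (r , ≤-refl , ≤-refl , y∈mid))
  ... | inj₂ (inj₂ eq) = inj₂ (inj₂ (B r , ≤-refl , ≤-refl , eq))

  rung-unique : ∀ r → Unique (c (A r) ∷ rung-tail r)
  rung-unique r with Rung.inner-short (rung r)
  ... | inj₁ eq rewrite eq = (c≢p (A r) (B r) (A<M r) (B<L r) ∷ []) ∷ [] ∷ []
  ... | inj₂ (w , eq) rewrite eq =
        ((λ c≡w → mid∉c r w (A r) (subst (w ∈_) (sym eq) (here refl)) (A<M r) (sym c≡w))
          ∷ c≢p (A r) (B r) (A<M r) (B<L r) ∷ [])
        ∷ ((λ w≡p → mid∉p r w (B r) (subst (w ∈_) (sym eq) (here refl)) (B<L r) w≡p) ∷ [])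
        ∷ [] ∷ []

  rung-last : ∀ r → lastOf (c (A r)) (rung-tail r) ≡ p (B r)
  rung-last r = lastOf-++-∷ (c (A r)) (mid r) (p (B r)) []

  rung-linked : ∀ r → Linked (Adj G) (c (A r) ∷ rung-tail r)
  rung-linked r = Rung.linked (rung r)

  c-apart : ∀ {a e} → e < M → ∀ {x y} → a ≤ x → x < y → y ≤ e → c x ≢ c y
  c-apart e<M _ x<y y≤e eq =
    <⇒≢ x<y (c-injective _ _ (<-trans x<y (≤-<-trans y≤e e<M)) (≤-<-trans y≤e e<M) eq)

  p-apart : ∀ {a e} → e < L → ∀ {x y} → a ≤ x → x < y → y ≤ e → p x ≢ p y
  p-apart e<L _ x<y y≤e eq =
    <⇒≢ x<y (p-injective _ _ (<-trans x<y (≤-<-trans y≤e e<L)) (≤-<-trans y≤e e<L) eq)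

  mkPath : (h : V) (t : List V) → Unique (h ∷ t) → Linked (Adj G) (h ∷ t) → Path (Adj G)
  mkPath h t u l = record { verts = h ∷ t ; unique = u ; linked = l }

  -- The j-th bead is the θ-graph on rungs 3j, 3j+1, 3j+2 between u = c (A (3j+1)) and v = p (B (3j+1)):
  -- leg 1 runs down the cycle to rung 3j and back up the path, leg 2 up the cycle to rung 3j+2 and back
  -- down the path, and leg 3 is rung 3j+1.
  module Bead (j : ℕ) (j<k : j < k) where
    r0 r1 r2 : ℕ
    r0 = 3 * j
    r1 = suc r0
    r2 = suc r1

    r2<N : r2 < N
    r2<N = triple-< j<k
    r1<N : r1 < N
    r1<N = <-trans (n<1+n r1) r2<N
    r0<N : r0 < N
    r0<N = <-trans (n<1+n r0) r1<N

    a0 a1 a2 b0 b1 b2 : ℕ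
    a0 = A r0
    a1 = A r1
    a2 = A r2
    b0 = B r0
    b1 = B r1
    b2 = B r2

    a0<a1 : a0 < a1
    a0<a1 = foot-increasing r0 r1 (n<1+n r0) r1<N
    a1<a2 : a1 < a2
    a1<a2 = foot-increasing r1 r2 (n<1+n r1) r2<N
    b0<b1 : b0 < b1
    b0<b1 = top-increasing r0 r1 (n<1+n r0) r1<N
    b1<b2 : b1 < b2
    b1<b2 = top-increasing r1 r2 (n<1+n r1) r2<N

    a01 : a0 ≤ a1
    a01 = <⇒≤ a0<a1
    a12 : a1 ≤ a2
    a12 = <⇒≤ a1<a2
    b01 : b0 ≤ b1
    b01 = <⇒≤ b0<b1
    b12 : b1 ≤ b2
    b12 = <⇒≤ b1<b2

    a0<M : a0 < M
    a0<M = A<M r0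
    a1<M : a1 < M
    a1<M = A<M r1
    a2<M : a2 < M
    a2<M = A<M r2
    b0<L : b0 < L
    b0<L = B<L r0
    b1<L : b1 < L
    b1<L = B<L r1
    b2<L : b2 < L
    b2<L = B<L r2

    leg₁-tail : List V
    leg₁-tail = Descent.tail c a01 ++ (rung-tail r0 ++ Ascent.tail p b01)

    module Leg₁ = Glue (c a1) (Descent.tail c a01) (rung-tail r0 ++ Ascent.tail p b01) (Descent.last c a01)
    module Leg₁′ = Glue (c a0) (rung-tail r0) (Ascent.tail p b01) (rung-last r0)

    leg₁-Region : ∀ {y} → y ∈ c a1 ∷ leg₁-tail → Region a0 a1 r0 r0 b0 b1 y
    leg₁-Region y∈ with Leg₁.∈⁻ y∈
    ... | inj₁ y∈c = inj₁ (Descent.∈⁻ c a01 y∈c)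
    ... | inj₂ y∈′ with Leg₁′.∈⁻ y∈′
    ...   | inj₁ y∈r = Region-mono ≤-refl a01 ≤-refl ≤-refl ≤-refl b01 (rung-Region r0 y∈r)
    ...   | inj₂ y∈p = inj₂ (inj₂ (Ascent.∈⁻ p b01 y∈p))

    leg₁-unique : Unique (c a1 ∷ leg₁-tail)
    leg₁-unique = Leg₁.Unique⁺ (Descent.Unique⁺ c a01 (c-apart a1<M))
                    (Leg₁′.Unique⁺ (rung-unique r0) (Ascent.Unique⁺ p b01 (p-apart b1<L)) rung∉path) cycle∉rest
      where
      rung∉path : ∀ {y} → y ∈ c a0 ∷ rung-tail r0 → y ∈ Ascent.tail p b01 → ⊥
      rung∉path y∈ y∈′ with Ascent.tail-∈⁻ p b01 y∈′
      ... | x , b0<x , x≤b1 , refl with rung-∈⁻ r0 y∈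
      ... | inj₁ eq = c≢p a0 x a0<M (≤-<-trans x≤b1 b1<L) (sym eq)
      ... | inj₂ (inj₁ y∈mid) = mid∉p r0 _ x y∈mid (≤-<-trans x≤b1 b1<L) refl
      ... | inj₂ (inj₂ eq) = <⇒≢ b0<x (sym (p-injective x b0 (≤-<-trans x≤b1 b1<L) b0<L eq))
      cycle∉rest : ∀ {y} → y ∈ c a1 ∷ Descent.tail c a01 → y ∈ rung-tail r0 ++ Ascent.tail p b01 → ⊥
      cycle∉rest y∈ y∈′ with Descent.∈⁻ c a01 y∈ | ∈-++⁻ (rung-tail r0) y∈′
      ... | x , _ , x≤a1 , refl | inj₁ y∈r with rung-tail-∈⁻ r0 y∈r
      ...   | inj₁ y∈mid = mid∉c r0 _ x y∈mid (≤-<-trans x≤a1 a1<M) refl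
      ...   | inj₂ eq = c≢p x b0 (≤-<-trans x≤a1 a1<M) b0<L eq
      cycle∉rest y∈ y∈′ | x , _ , x≤a1 , refl | inj₂ y∈p with Ascent.tail-∈⁻ p b01 y∈p
      ...   | x′ , _ , x′≤b1 , eq = c≢p x x′ (≤-<-trans x≤a1 a1<M) (≤-<-trans x′≤b1 b1<L) eq

    leg₁-linked : Linked (Adj G) (c a1 ∷ leg₁-tail)
    leg₁-linked = Leg₁.Linked⁺ (Descent.Linked⁺ c a01 (λ {x} _ x<a1 → Adj-sym G (c-adjacent x (≤-<-trans x<a1 a1<M))))
                    (Leg₁′.Linked⁺ (rung-linked r0) (Ascent.Linked⁺ p b01 (λ {x} _ x<b1 → p-adjacent x (≤-<-trans x<b1 b1<L))))

    leg₁-last : lastOf (c a1) leg₁-tail ≡ p b1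
    leg₁-last = trans Leg₁.last (trans Leg₁′.last (Ascent.last p b01))

    c-a0∈leg₁ : c a0 ∈ c a1 ∷ leg₁-tail
    c-a0∈leg₁ = Leg₁.∈⁺ʳ (here refl)

    leg₂-tail : List V
    leg₂-tail = Ascent.tail c a12 ++ (rung-tail r2 ++ Descent.tail p b12)

    module Leg₂ = Glue (c a1) (Ascent.tail c a12) (rung-tail r2 ++ Descent.tail p b12) (Ascent.last c a12)
    module Leg₂′ = Glue (c a2) (rung-tail r2) (Descent.tail p b12) (rung-last r2)

    leg₂-Region : ∀ {y} → y ∈ c a1 ∷ leg₂-tail → Region a1 a2 r2 r2 b1 b2 y
    leg₂-Region y∈ with Leg₂.∈⁻ y∈
    ... | inj₁ y∈c = inj₁ (Ascent.∈⁻ c a12 y∈c)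
    ... | inj₂ y∈′ with Leg₂′.∈⁻ y∈′
    ...   | inj₁ y∈r = Region-mono a12 ≤-refl ≤-refl ≤-refl b12 ≤-refl (rung-Region r2 y∈r)
    ...   | inj₂ y∈p = inj₂ (inj₂ (Descent.∈⁻ p b12 y∈p))

    leg₂-unique : Unique (c a1 ∷ leg₂-tail)
    leg₂-unique = Leg₂.Unique⁺ (Ascent.Unique⁺ c a12 (c-apart a2<M))
                    (Leg₂′.Unique⁺ (rung-unique r2) (Descent.Unique⁺ p b12 (p-apart b2<L)) rung∉path) cycle∉rest
      where
      rung∉path : ∀ {y} → y ∈ c a2 ∷ rung-tail r2 → y ∈ Descent.tail p b12 → ⊥
      rung∉path y∈ y∈′ with Descent.tail-∈⁻ p b12 y∈′
      ... | x , _ , x<b2 , refl with rung-∈⁻ r2 y∈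
      ... | inj₁ eq = c≢p a2 x a2<M (<-trans x<b2 b2<L) (sym eq)
      ... | inj₂ (inj₁ y∈mid) = mid∉p r2 _ x y∈mid (<-trans x<b2 b2<L) refl
      ... | inj₂ (inj₂ eq) = <⇒≢ x<b2 (p-injective x b2 (<-trans x<b2 b2<L) b2<L eq)
      cycle∉rest : ∀ {y} → y ∈ c a1 ∷ Ascent.tail c a12 → y ∈ rung-tail r2 ++ Descent.tail p b12 → ⊥
      cycle∉rest y∈ y∈′ with Ascent.∈⁻ c a12 y∈ | ∈-++⁻ (rung-tail r2) y∈′
      ... | x , _ , x≤a2 , refl | inj₁ y∈r with rung-tail-∈⁻ r2 y∈r
      ...   | inj₁ y∈mid = mid∉c r2 _ x y∈mid (≤-<-trans x≤a2 a2<M) refl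
      ...   | inj₂ eq = c≢p x b2 (≤-<-trans x≤a2 a2<M) b2<L eq
      cycle∉rest y∈ y∈′ | x , _ , x≤a2 , refl | inj₂ y∈p with Descent.tail-∈⁻ p b12 y∈p
      ...   | x′ , _ , x′<b2 , eq = c≢p x x′ (≤-<-trans x≤a2 a2<M) (<-trans x′<b2 b2<L) eq

    leg₂-linked : Linked (Adj G) (c a1 ∷ leg₂-tail)
    leg₂-linked = Leg₂.Linked⁺ (Ascent.Linked⁺ c a12 (λ {x} _ x<a2 → c-adjacent x (≤-<-trans x<a2 a2<M)))
                    (Leg₂′.Linked⁺ (rung-linked r2)
                      (Descent.Linked⁺ p b12 (λ {x} _ x<b2 → Adj-sym G (p-adjacent x (≤-<-trans x<b2 b2<L)))))

    leg₂-last : lastOf (c a1) leg₂-tail ≡ p b1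
    leg₂-last = trans Leg₂.last (trans Leg₂′.last (Descent.last p b12))

    c-a2∈leg₂ : c a2 ∈ c a1 ∷ leg₂-tail
    c-a2∈leg₂ = Leg₂.∈⁺ʳ (here refl)

    legs : Fin 3 → Path (Adj G)
    legs zero = mkPath (c a1) leg₁-tail leg₁-unique leg₁-linked
    legs (suc zero) = mkPath (c a1) leg₂-tail leg₂-unique leg₂-linked
    legs (suc (suc zero)) = mkPath (c a1) (rung-tail r1) (rung-unique r1) (rung-linked r1)

    legs-Region : ∀ t {y} → VP (legs t) y → Region a0 a2 r0 r2 b0 b2 y
    legs-Region zero y∈ = Region-mono ≤-refl a12 ≤-refl (≤-trans (n≤1+n r0) (n≤1+n r1)) ≤-refl b12 (leg₁-Region y∈)
    legs-Region (suc zero) y∈ = Region-mono a01 ≤-refl (≤-trans (n≤1+n r0) (n≤1+n r1)) ≤-refl b01 ≤-refl (leg₂-Region y∈)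
    legs-Region (suc (suc zero)) y∈ = Region-mono a01 a12 (n≤1+n r0) (n≤1+n r1) b01 b12 (rung-Region r1 y∈)

    legs-end : ∀ t → end (legs t) ≡ p b1
    legs-end zero = trans (last≡lastOf (c a1) leg₁-tail) leg₁-last
    legs-end (suc zero) = trans (last≡lastOf (c a1) leg₂-tail) leg₂-last
    legs-end (suc (suc zero)) = trans (last≡lastOf (c a1) (rung-tail r1)) (rung-last r1)

    legs-start : ∀ t → start (legs t) ≡ c a1
    legs-start zero = refl
    legs-start (suc zero) = refl
    legs-start (suc (suc zero)) = refl

    left∩right : ∀ {r r′ y} → r < N → r′ < N → r ≢ r′ →
                 Region a0 a1 r r b0 b1 y → Region a1 a2 r′ r′ b1 b2 y → y ≡ c a1 ⊎ y ≡ p b1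
    left∩right r<N r′<N r≢r′ y∈ y∈′
      with Region∩Region a1<M a2<M r<N r′<N b1<L b2<L
             (λ _ (r≤ , ≤r) (r′≤ , ≤r′) → r≢r′ (≤-antisym (≤-trans r≤ ≤r′) (≤-trans r′≤ ≤r))) y∈ y∈′
    ... | inj₁ (x , (_ , x≤a1) , (a1≤x , _) , eq) = inj₁ (subst (λ z → _ ≡ c z) (≤-antisym x≤a1 a1≤x) eq)
    ... | inj₂ (x , (_ , x≤b1) , (b1≤x , _) , eq) = inj₂ (subst (λ z → _ ≡ p z) (≤-antisym x≤b1 b1≤x) eq)

    leg₃-left : ∀ {y} → VP (legs (suc (suc zero))) y → Region a0 a1 r1 r1 b0 b1 y
    leg₃-left y∈ = Region-mono a01 ≤-refl ≤-refl ≤-refl b01 ≤-refl (rung-Region r1 y∈)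

    leg₃-right : ∀ {y} → VP (legs (suc (suc zero))) y → Region a1 a2 r1 r1 b1 b2 y
    leg₃-right y∈ = Region-mono ≤-refl a12 ≤-refl ≤-refl ≤-refl b12 (rung-Region r1 y∈)

    r0≢r1 : r0 ≢ r1
    r0≢r1 = <⇒≢ (n<1+n r0)
    r0≢r2 : r0 ≢ r2
    r0≢r2 = <⇒≢ (<-trans (n<1+n r0) (n<1+n r1))
    r1≢r2 : r1 ≢ r2
    r1≢r2 = <⇒≢ (n<1+n r1)

    legs-meet : ∀ s t → s ≢ t → ∀ {y} → VP (legs s) y → VP (legs t) y → y ≡ c a1 ⊎ y ≡ p b1
    legs-meet zero zero s≢t = ⊥-elim (s≢t refl)
    legs-meet zero (suc zero) _ y∈ y∈′ = left∩right r0<N r2<N r0≢r2 (leg₁-Region y∈) (leg₂-Region y∈′)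
    legs-meet zero (suc (suc zero)) _ y∈ y∈′ = left∩right r0<N r1<N r0≢r1 (leg₁-Region y∈) (leg₃-right y∈′)
    legs-meet (suc zero) zero _ y∈ y∈′ = left∩right r0<N r2<N r0≢r2 (leg₁-Region y∈′) (leg₂-Region y∈)
    legs-meet (suc zero) (suc zero) s≢t = ⊥-elim (s≢t refl)
    legs-meet (suc zero) (suc (suc zero)) _ y∈ y∈′ = left∩right r1<N r2<N r1≢r2 (leg₃-left y∈′) (leg₂-Region y∈)
    legs-meet (suc (suc zero)) zero _ y∈ y∈′ = left∩right r0<N r1<N r0≢r1 (leg₁-Region y∈′) (leg₃-right y∈)
    legs-meet (suc (suc zero)) (suc zero) _ y∈ y∈′ = left∩right r1<N r2<N r1≢r2 (leg₃-left y∈) (leg₂-Region y∈′)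
    legs-meet (suc (suc zero)) (suc (suc zero)) s≢t = ⊥-elim (s≢t refl)

    c-a0∉leg₂ : ¬ VP (legs (suc zero)) (c a0)
    c-a0∉leg₂ y∈ = c∉Region a0<M a2<M b2<L (inj₁ a0<a1) (leg₂-Region y∈)
    c-a0∉leg₃ : ¬ VP (legs (suc (suc zero))) (c a0)
    c-a0∉leg₃ y∈ = c∉Region a0<M a1<M b1<L (inj₁ a0<a1) (rung-Region r1 y∈)
    c-a2∉leg₁ : ¬ VP (legs zero) (c a2)
    c-a2∉leg₁ y∈ = c∉Region a2<M a1<M b1<L (inj₂ a1<a2) (leg₁-Region y∈)
    c-a2∉leg₃ : ¬ VP (legs (suc (suc zero))) (c a2)
    c-a2∉leg₃ y∈ = c∉Region a2<M a1<M b1<L (inj₂ a1<a2) (rung-Region r1 y∈)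

    legs-distinct : ∀ s t → s ≢ t → verts (legs s) ≢ verts (legs t)
    legs-distinct zero (suc zero) _ eq = c-a0∉leg₂ (subst (λ vs → c a0 ∈ toList vs) eq c-a0∈leg₁)
    legs-distinct zero (suc (suc zero)) _ eq = c-a0∉leg₃ (subst (λ vs → c a0 ∈ toList vs) eq c-a0∈leg₁)
    legs-distinct (suc zero) zero _ eq = c-a2∉leg₁ (subst (λ vs → c a2 ∈ toList vs) eq c-a2∈leg₂)
    legs-distinct (suc zero) (suc (suc zero)) _ eq = c-a2∉leg₃ (subst (λ vs → c a2 ∈ toList vs) eq c-a2∈leg₂)
    legs-distinct (suc (suc zero)) zero _ eq = legs-distinct zero (suc (suc zero)) (λ ()) (sym eq)
    legs-distinct (suc (suc zero)) (suc zero) _ eq = legs-distinct (suc zero) (suc (suc zero)) (λ ()) (sym eq)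
    legs-distinct zero zero s≢t = ⊥-elim (s≢t refl)
    legs-distinct (suc zero) (suc zero) s≢t = ⊥-elim (s≢t refl)
    legs-distinct (suc (suc zero)) (suc (suc zero)) s≢t = ⊥-elim (s≢t refl)

    theta : Theta G
    theta = record
      { u = c a1 ; v = p b1 ; u≢v = c≢p a1 b1 a1<M b1<L
      ; leg = legs ; leg-start = legs-start ; leg-end = legs-end
      ; leg-distinct = legs-distinct ; leg-intdisj = inner-disjoint′ }
      where
      inner-disjoint′ : ∀ s t → s ≢ t → Disjoint (Inner (legs s)) (Inner (legs t))
      inner-disjoint′ s t s≢t y (y∈ , y≢u , y≢v) (y∈′ , _ , _) with legs-meet s t s≢t y∈ y∈′
      ... | inj₁ y≡u = y≢u (trans y≡u (sym (legs-start s)))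
      ... | inj₂ y≡v = y≢v (trans y≡v (sym (legs-end s)))

    theta-Region : ∀ {y} → VΘ theta y → Region a0 a2 r0 r2 b0 b2 y
    theta-Region (t , y∈) = legs-Region t y∈

    leg₃-length : len (legs (suc (suc zero))) ≡ suc d
    leg₃-length = trans (List.length-++ (mid r1)) (trans (+-comm (length (mid r1)) 1) (cong suc (inner-length r1 r1<N)))

  module Link (j : ℕ) (sj : suc j < k) where
    j<k : j < k
    j<k = <-trans (n<1+n j) sj

    from to : ℕ
    from = Bead.a2 j j<k
    to = Bead.a0 (suc j) sj

    from≤to : from ≤ to
    from≤to = <⇒≤ (foot-increasing _ _ (triple-< (n<1+n j)) (Bead.r0<N (suc j) sj))

    to<M : to < M
    to<M = A<M _

    path : Path (Adj G)
    path = mkPath (c from) (Ascent.tail c from≤to) (Ascent.Unique⁺ c from≤to (c-apart to<M))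
             (Ascent.Linked⁺ c from≤to (λ {x} _ x<to → c-adjacent x (≤-<-trans x<to to<M)))

    ∈⁻ : ∀ {y} → VP path y → OnCycle from to y
    ∈⁻ = Ascent.∈⁻ c from≤to

    path-end : end path ≡ c to
    path-end = trans (last≡lastOf (c from) (Ascent.tail c from≤to)) (Ascent.last c from≤to)

  module Wrap where
    module First = Bead 0 (s≤s z≤n)
    module Last = Bead K ≤-refl

    from : ℕ
    from = Last.a2

    0<M : 0 < M
    0<M = ≤-<-trans z≤n Last.a2<M

    from≤ : from ≤ M ∸ 1
    from≤ = <⇒≤pred Last.a2<M

    A0<from : A 0 < from
    A0<from = foot-increasing 0 Last.r2 (s≤s z≤n) Last.r2<N

    upper lower : List V
    upper = Ascent.tail c from≤
    lower = Ascent.tail c {0} {A 0} z≤n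

    path-unique : Unique (c from ∷ upper ++ c 0 ∷ lower)
    path-unique = Unique.++⁺ {xs = c from ∷ upper} (Ascent.Unique⁺ c from≤ (c-apart (pred< 0<M)))
                    (Ascent.Unique⁺ c z≤n (c-apart First.a0<M)) (λ (y∈ , y∈′) → apart y∈ y∈′)
      where
      apart : ∀ {y} → y ∈ c from ∷ upper → y ∈ c 0 ∷ lower → ⊥
      apart y∈ y∈′ with Ascent.∈⁻ c from≤ y∈ | Ascent.∈⁻ c {0} {A 0} z≤n y∈′
      ... | x , from≤x , x≤ , refl | x′ , _ , x′≤ , eq
        with c-injective x x′ (≤-<-trans x≤ (pred< 0<M)) (≤-<-trans x′≤ First.a0<M) eq
      ... | refl = <⇒≱ A0<from (≤-trans from≤x x′≤)

    path-linked : Linked (Adj G) (c from ∷ upper ++ c 0 ∷ lower)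
    path-linked = Linked-++-∷ (c from) upper (c 0) lower
                    (subst (λ w → Adj G w (c 0)) (sym (Ascent.last c from≤)) c-closes)
                    (Ascent.Linked⁺ c from≤ (λ {x} _ x< → c-adjacent x (≤-<-trans x< (pred< 0<M))))
                    (Ascent.Linked⁺ c z≤n (λ {x} _ x< → c-adjacent x (≤-<-trans x< First.a0<M)))

    path : Path (Adj G)
    path = mkPath (c from) (upper ++ c 0 ∷ lower) path-unique path-linked

    ∈⁻ : ∀ {y} → VP path y → OnCycle from (M ∸ 1) y ⊎ OnCycle 0 (A 0) y
    ∈⁻ y∈ with ∈-++⁻ (c from ∷ upper) y∈
    ... | inj₁ y∈u = inj₁ (Ascent.∈⁻ c from≤ y∈u)
    ... | inj₂ y∈l = inj₂ (Ascent.∈⁻ c z≤n y∈l)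

    path-end : end path ≡ c (A 0)
    path-end = trans (last≡lastOf (c from) (upper ++ c 0 ∷ lower))
                 (trans (lastOf-++-∷ (c from) upper (c 0) lower) (Ascent.last c {0} {A 0} z≤n))

  beads : Fin k → Theta G
  beads j = Bead.theta (toℕ j) (Fin.toℕ<n j)

  link : ∀ j → Dec (suc j < k) → Path (Adj G)
  link j (yes sj) = Link.path j sj
  link j (no _) = Wrap.path

  links : Fin k → Path (Adj G)
  links j = link (toℕ j) (suc (toℕ j) <? k)

  P-link-next : ∀ j (j<k : j < k) (sj : suc j < k) J (J<k : J < k) → J ≡ suc j →
                IsABPath (VP (L₂ (Bead.theta j j<k))) (VP (L₁ (Bead.theta J J<k))) (Link.path j sj)
  P-link-next j j<k sj J J<k refl =
    inj₁ (Bead.c-a2∈leg₂ j j<k , subst (VP (L₁ (Bead.theta J J<k))) (sym (Link.path-end j sj)) (Bead.c-a0∈leg₁ J J<k)) ,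
    avoids
    where
    module Bj = Bead j j<k
    module BJ = Bead J J<k
    avoids : ∀ x → Inner (Link.path j sj) x → ¬ (VP (L₂ (Bead.theta j j<k)) x ⊎ VP (L₁ (Bead.theta J J<k)) x)
    avoids x (x∈ , x≢start , _) (inj₁ x∈₂)
      with cycle∩Region (Link.to<M j sj) Bj.a2<M Bj.b2<L (Link.∈⁻ j sj x∈) (Bj.leg₂-Region x∈₂)
    ... | z , (from≤z , _) , (_ , z≤a2) , refl = x≢start (cong c (≤-antisym z≤a2 from≤z))
    avoids x (x∈ , _ , x≢end) (inj₂ x∈₁)
      with cycle∩Region (Link.to<M j sj) BJ.a1<M BJ.b1<L (Link.∈⁻ j sj x∈) (BJ.leg₁-Region x∈₁)
    ... | z , (_ , z≤to) , (a0≤z , _) , refl = x≢end (trans (cong c (≤-antisym z≤to a0≤z)) (sym (Link.path-end j sj)))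

  P-link-wrap : ∀ j (j<k : j < k) (nsj : ¬ suc j < k) J (J<k : J < k) → J ≡ 0 →
                IsABPath (VP (L₂ (Bead.theta j j<k))) (VP (L₁ (Bead.theta J J<k))) Wrap.path
  P-link-wrap j j<k nsj J J<k refl with ≤-antisym (≤-pred j<k) (≤-pred (≮⇒≥ nsj))
  ... | refl = inj₁ (Bead.c-a2∈leg₂ K j<k , subst (VP (L₁ (Bead.theta 0 J<k))) (sym Wrap.path-end) (Bead.c-a0∈leg₁ 0 J<k)) ,
               avoids
    where
    module BK = Bead K j<k
    module B0 = Bead 0 J<k
    A0<a1 : A 0 < BK.a1
    A0<a1 = foot-increasing 0 BK.r1 (s≤s z≤n) BK.r1<N
    a1<from : B0.a1 < Wrap.from
    a1<from = foot-increasing 1 BK.r2 (s≤s (s≤s z≤n)) BK.r2<N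
    avoids : ∀ x → Inner Wrap.path x → ¬ (VP (L₂ (Bead.theta K j<k)) x ⊎ VP (L₁ (Bead.theta 0 J<k)) x)
    avoids x (x∈ , x≢start , _) (inj₁ x∈₂) with Wrap.∈⁻ x∈
    ... | inj₁ x∈u with cycle∩Region (pred< Wrap.0<M) BK.a2<M BK.b2<L x∈u (BK.leg₂-Region x∈₂)
    ...   | z , (from≤z , _) , (_ , z≤a2) , refl = x≢start (cong c (≤-antisym z≤a2 from≤z))
    avoids x (x∈ , x≢start , _) (inj₁ x∈₂) | inj₂ x∈l
      with cycle∩Region B0.a0<M BK.a2<M BK.b2<L x∈l (BK.leg₂-Region x∈₂)
    ...   | z , (_ , z≤A0) , (a1≤z , _) , _ = <⇒≱ A0<a1 (≤-trans a1≤z z≤A0)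
    avoids x (x∈ , _ , x≢end) (inj₂ x∈₁) with Wrap.∈⁻ x∈
    ... | inj₁ x∈u with cycle∩Region (pred< Wrap.0<M) B0.a1<M B0.b1<L x∈u (B0.leg₁-Region x∈₁)
    ...   | z , (from≤z , _) , (_ , z≤a1) , _ = <⇒≱ a1<from (≤-trans from≤z z≤a1)
    avoids x (x∈ , _ , x≢end) (inj₂ x∈₁) | inj₂ x∈l
      with cycle∩Region B0.a0<M B0.a1<M B0.b1<L x∈l (B0.leg₁-Region x∈₁)
    ...   | z , (_ , z≤A0) , (A0≤z , _) , refl = x≢end (trans (cong c (≤-antisym z≤A0 A0≤z)) (sym Wrap.path-end))

  P-link : ∀ j → IsABPath (VP (L₂ (beads j))) (VP (L₁ (beads (cyc j)))) (links j)
  P-link j with suc (toℕ j) <? k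
  ... | yes sj = P-link-next (toℕ j) (Fin.toℕ<n j) sj _ (Fin.toℕ<n (fromℕ< sj)) (Fin.toℕ-fromℕ< sj)
  ... | no nsj = P-link-wrap (toℕ j) (Fin.toℕ<n j) nsj 0 (s≤s z≤n) refl

  Link-inner : ∀ j (sj : suc j < k) J (J<k : J < k) → Disjoint (Inner (Link.path j sj)) (VΘ (Bead.theta J J<k))
  Link-inner j sj J J<k x (x∈ , x≢start , x≢end) x∈θ
    with cycle∩Region (Link.to<M j sj) (Bead.a2<M J J<k) (Bead.b2<L J J<k) (Link.∈⁻ j sj x∈) (Bead.theta-Region J J<k x∈θ)
  ... | z , (from≤z , z≤to) , (a0≤z , z≤a2) , refl with ≤-<-connex J j
  ...   | inj₁ J≤j = x≢start (cong c (≤-antisym (≤-trans z≤a2 a2≤from) from≤z))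
    where
    a2≤from : Bead.a2 J J<k ≤ Link.from j sj
    a2≤from = A-mono _ _ (+-monoʳ-≤ 2 (*-monoʳ-≤ 3 J≤j)) (Bead.r2<N j (Link.j<k j sj))
  ...   | inj₂ j<J = x≢end (trans (cong c (≤-antisym z≤to (≤-trans to≤a0 a0≤z))) (sym (Link.path-end j sj)))
    where
    to≤a0 : Link.to j sj ≤ Bead.a0 J J<k
    to≤a0 = A-mono _ _ (*-monoʳ-≤ 3 j<J) (Bead.r0<N J J<k)

  Wrap-inner : ∀ J (J<k : J < k) → Disjoint (Inner Wrap.path) (VΘ (Bead.theta J J<k))
  Wrap-inner J J<k x (x∈ , x≢start , x≢end) x∈θ with Wrap.∈⁻ x∈
  ... | inj₁ x∈u with cycle∩Region (pred< Wrap.0<M) (Bead.a2<M J J<k) (Bead.b2<L J J<k) x∈u (Bead.theta-Region J J<k x∈θ)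
  ...   | z , (from≤z , _) , (_ , z≤a2) , refl = x≢start (cong c (≤-antisym (≤-trans z≤a2 a2≤from) from≤z))
    where
    a2≤from : Bead.a2 J J<k ≤ Wrap.from
    a2≤from = A-mono _ _ (+-monoʳ-≤ 2 (*-monoʳ-≤ 3 (≤-pred J<k))) Wrap.Last.r2<N
  Wrap-inner J J<k x (x∈ , x≢start , x≢end) x∈θ | inj₂ x∈l
    with cycle∩Region Wrap.First.a0<M (Bead.a2<M J J<k) (Bead.b2<L J J<k) x∈l (Bead.theta-Region J J<k x∈θ)
  ...   | z , (_ , z≤A0) , (a0≤z , _) , refl =
          x≢end (trans (cong c (≤-antisym z≤A0 (≤-trans (A-mono 0 _ z≤n (Bead.r0<N J J<k)) a0≤z))) (sym Wrap.path-end))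

  P-inner : ∀ j j′ → Disjoint (Inner (links j)) (VΘ (beads j′))
  P-inner j j′ with suc (toℕ j) <? k
  ... | yes sj = Link-inner (toℕ j) sj (toℕ j′) (Fin.toℕ<n j′)
  ... | no _ = Wrap-inner (toℕ j′) (Fin.toℕ<n j′)

  beads-disjoint-< : ∀ J J′ (J<k : J < k) (J′<k : J′ < k) → J < J′ →
                     Disjoint (VΘ (Bead.theta J J<k)) (VΘ (Bead.theta J′ J′<k))
  beads-disjoint-< J J′ J<k J′<k J<J′ x x∈ x∈′
    with Region∩Region (Bead.a2<M J J<k) (Bead.a2<M J′ J′<k) (Bead.r2<N J J<k) (Bead.r2<N J′ J′<k)
           (Bead.b2<L J J<k) (Bead.b2<L J′ J′<k) (λ r (_ , r≤) (≤r , _) → <⇒≱ (triple-< J<J′) (≤-trans ≤r r≤))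
           (Bead.theta-Region J J<k x∈) (Bead.theta-Region J′ J′<k x∈′)
  ... | inj₁ (_ , (_ , z≤) , (≤z , _) , _) =
        <⇒≱ (foot-increasing _ _ (triple-< J<J′) (Bead.r0<N J′ J′<k)) (≤-trans ≤z z≤)
  ... | inj₂ (_ , (_ , z≤) , (≤z , _) , _) =
        <⇒≱ (top-increasing _ _ (triple-< J<J′) (Bead.r0<N J′ J′<k)) (≤-trans ≤z z≤)

  Θ-disjoint : ∀ j j′ → j ≢ j′ → Disjoint (VΘ (beads j)) (VΘ (beads j′))
  Θ-disjoint j j′ j≢j′ x x∈ x∈′ with <-cmp (toℕ j) (toℕ j′)
  ... | tri< lt _ _ = beads-disjoint-< _ _ _ _ lt x x∈ x∈′
  ... | tri≈ _ eq _ = j≢j′ (Fin.toℕ-injective eq)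
  ... | tri> _ _ gt = beads-disjoint-< _ _ _ _ gt x x∈′ x∈

  links-disjoint-< : ∀ j j′ (sj : suc j < k) (sj′ : suc j′ < k) → j < j′ →
                     Disjoint (VP (Link.path j sj)) (VP (Link.path j′ sj′))
  links-disjoint-< j j′ sj sj′ j<j′ x x∈ x∈′
    with cycle∩cycle (Link.to<M j sj) (Link.to<M j′ sj′) (Link.∈⁻ j sj x∈) (Link.∈⁻ j′ sj′ x∈′)
  ... | _ , (_ , z≤) , (≤z , _) , _ =
        <⇒≱ (foot-increasing _ _ (≤-<-trans (*-monoʳ-≤ 3 j<j′) (s≤s (n≤1+n _))) (Bead.r2<N j′ (Link.j<k j′ sj′)))
            (≤-trans ≤z z≤)

  link-Wrap-disjoint : ∀ j (sj : suc j < k) → Disjoint (VP (Link.path j sj)) (VP Wrap.path)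
  link-Wrap-disjoint j sj x x∈ x∈′ with Wrap.∈⁻ x∈′
  ... | inj₁ x∈u with cycle∩cycle (Link.to<M j sj) (pred< Wrap.0<M) (Link.∈⁻ j sj x∈) x∈u
  ...   | _ , (_ , z≤) , (≤z , _) , _ =
          <⇒≱ (foot-increasing _ _ (≤-<-trans (*-monoʳ-≤ 3 (≤-pred sj)) (s≤s (n≤1+n _))) Wrap.Last.r2<N) (≤-trans ≤z z≤)
  link-Wrap-disjoint j sj x x∈ x∈′ | inj₂ x∈l with cycle∩cycle (Link.to<M j sj) Wrap.First.a0<M (Link.∈⁻ j sj x∈) x∈l
  ...   | _ , (≤z , _) , (_ , z≤) , _ =
          <⇒≱ (foot-increasing 0 _ (s≤s z≤n) (Bead.r2<N j (Link.j<k j sj))) (≤-trans ≤z z≤)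

  P-disjoint : ∀ j j′ → j ≢ j′ → Disjoint (VP (links j)) (VP (links j′))
  P-disjoint j j′ j≢j′ with suc (toℕ j) <? k | suc (toℕ j′) <? k
  ... | yes sj | yes sj′ = λ x x∈ x∈′ → by-order x x∈ x∈′
    where
    by-order : Disjoint (VP (Link.path (toℕ j) sj)) (VP (Link.path (toℕ j′) sj′))
    by-order x x∈ x∈′ with <-cmp (toℕ j) (toℕ j′)
    ... | tri< lt _ _ = links-disjoint-< _ _ sj sj′ lt x x∈ x∈′
    ... | tri≈ _ eq _ = j≢j′ (Fin.toℕ-injective eq)
    ... | tri> _ _ gt = links-disjoint-< _ _ sj′ sj gt x x∈′ x∈
  ... | yes sj | no _ = link-Wrap-disjoint _ sj
  ... | no _ | yes sj′ = λ x x∈ x∈′ → link-Wrap-disjoint _ sj′ x x∈′ x∈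
  ... | no nsj | no nsj′ = λ _ _ _ → j≢j′ (Fin.toℕ-injective (trans (last-index j nsj) (sym (last-index j′ nsj′))))
    where
    last-index : ∀ (i : Fin k) → ¬ suc (toℕ i) < k → toℕ i ≡ K
    last-index i nsi = ≤-antisym (≤-pred (Fin.toℕ<n i)) (≤-pred (≮⇒≥ nsi))

  headOr : List V → V → V
  headOr [] d = d
  headOr (w ∷ _) d = w

  above-foot below-top : ℕ → V
  above-foot r = headOr (mid r) (p (B r))
  below-top r = headOr (mid r) (c (A r))

  data HostEdge (y z : V) : Set where
    cycle-step  : ∀ x → suc x < M → y ≡ c x → z ≡ c (suc x) → HostEdge y z
    cycle-step⁻ : ∀ x → suc x < M → y ≡ c (suc x) → z ≡ c x → HostEdge y z
    cycle-wrap  : 0 < M → y ≡ c (M ∸ 1) → z ≡ c 0 → HostEdge y z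
    cycle-wrap⁻ : 0 < M → y ≡ c 0 → z ≡ c (M ∸ 1) → HostEdge y z
    path-step   : ∀ x → suc x < L → y ≡ p x → z ≡ p (suc x) → HostEdge y z
    path-step⁻  : ∀ x → suc x < L → y ≡ p (suc x) → z ≡ p x → HostEdge y z
    rung-step   : ∀ r → r < N → Consec y z (c (A r) ∷ rung-tail r) → HostEdge y z
    rung-step⁻  : ∀ r → r < N → Consec z y (c (A r) ∷ rung-tail r) → HostEdge y z

  HostEdge-sym : ∀ {y z} → HostEdge y z → HostEdge z y
  HostEdge-sym (cycle-step x x< e e′) = cycle-step⁻ x x< e′ e
  HostEdge-sym (cycle-step⁻ x x< e e′) = cycle-step x x< e′ e
  HostEdge-sym (cycle-wrap 0< e e′) = cycle-wrap⁻ 0< e′ e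
  HostEdge-sym (cycle-wrap⁻ 0< e e′) = cycle-wrap 0< e′ e
  HostEdge-sym (path-step x x< e e′) = path-step⁻ x x< e′ e
  HostEdge-sym (path-step⁻ x x< e e′) = path-step x x< e′ e
  HostEdge-sym (rung-step r r< cs) = rung-step⁻ r r< cs
  HostEdge-sym (rung-step⁻ r r< cs) = rung-step r r< cs

  rung-Consec : ∀ r {y z} → Consec y z (c (A r) ∷ rung-tail r) →
                (y ≡ c (A r) × z ≡ above-foot r) ⊎ (y ≡ below-top r × z ≡ p (B r))
  rung-Consec r with Rung.inner-short (rung r)
  ... | inj₁ eq = short
    where
    short : ∀ {y z} → Consec y z (c (A r) ∷ mid r ++ p (B r) ∷ []) →
            (y ≡ c (A r) × z ≡ above-foot r) ⊎ (y ≡ below-top r × z ≡ p (B r))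
    short cs rewrite eq with cs
    ... | here = inj₁ (refl , refl)
    ... | there (there ())
  ... | inj₂ (w , eq) = short
    where
    short : ∀ {y z} → Consec y z (c (A r) ∷ mid r ++ p (B r) ∷ []) →
            (y ≡ c (A r) × z ≡ above-foot r) ⊎ (y ≡ below-top r × z ≡ p (B r))
    short cs rewrite eq with cs
    ... | here = inj₁ (refl , refl)
    ... | there here = inj₂ (refl , refl)
    ... | there (there (there ()))

  module BeadEdges (J : ℕ) (J<k : J < k) where
    open Bead J J<k

    leg₁-HostEdge : ∀ {y z} → Consec y z (c a1 ∷ leg₁-tail) → HostEdge y z
    leg₁-HostEdge cs with Leg₁.Consec⁻ cs
    ... | inj₁ cs′ with Descent.Consec⁻ c a01 cs′
    ...   | x , _ , x< , e , e′ = cycle-step⁻ x (≤-<-trans x< a1<M) e e′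
    leg₁-HostEdge cs | inj₂ cs′ with Leg₁′.Consec⁻ cs′
    ...   | inj₁ cs″ = rung-step r0 r0<N cs″
    ...   | inj₂ cs″ with Ascent.Consec⁻ p b01 cs″
    ...     | x , _ , x< , e , e′ = path-step x (≤-<-trans x< b1<L) e e′

    leg₂-HostEdge : ∀ {y z} → Consec y z (c a1 ∷ leg₂-tail) → HostEdge y z
    leg₂-HostEdge cs with Leg₂.Consec⁻ cs
    ... | inj₁ cs′ with Ascent.Consec⁻ c a12 cs′
    ...   | x , _ , x< , e , e′ = cycle-step x (≤-<-trans x< a2<M) e e′
    leg₂-HostEdge cs | inj₂ cs′ with Leg₂′.Consec⁻ cs′
    ...   | inj₁ cs″ = rung-step r2 r2<N cs″
    ...   | inj₂ cs″ with Descent.Consec⁻ p b12 cs″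
    ...     | x , _ , x< , e , e′ = path-step⁻ x (≤-<-trans x< b2<L) e e′

    legs-HostEdge : ∀ t {y z} → Consec y z (toList (verts (legs t))) → HostEdge y z
    legs-HostEdge zero = leg₁-HostEdge
    legs-HostEdge (suc zero) = leg₂-HostEdge
    legs-HostEdge (suc (suc zero)) = rung-step r1 r1<N

  link-HostEdge : ∀ j (sj : suc j < k) {y z} → Consec y z (toList (verts (Link.path j sj))) → HostEdge y z
  link-HostEdge j sj cs with Ascent.Consec⁻ c (Link.from≤to j sj) cs
  ... | x , _ , x< , e , e′ = cycle-step x (≤-<-trans x< (Link.to<M j sj)) e e′

  Wrap-HostEdge : ∀ {y z} → Consec y z (toList (verts Wrap.path)) → HostEdge y z
  Wrap-HostEdge cs with Consec-++-∷ (c Wrap.from) Wrap.upper (c 0) Wrap.lower cs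
  ... | inj₁ cs′ with Ascent.Consec⁻ c Wrap.from≤ cs′
  ...   | x , _ , x< , e , e′ = cycle-step x (≤-<-trans x< (pred< Wrap.0<M)) e e′
  Wrap-HostEdge cs | inj₂ (inj₁ cs′) with Ascent.Consec⁻ c {0} {A 0} z≤n cs′
  ...   | x , _ , x< , e , e′ = cycle-step x (≤-<-trans x< Wrap.First.a0<M) e e′
  Wrap-HostEdge cs | inj₂ (inj₂ (e , e′)) = cycle-wrap Wrap.0<M (trans e (Ascent.last c Wrap.from≤)) e′

  links-HostEdge : ∀ j {y z} → Consec y z (toList (verts (links j))) → HostEdge y z
  links-HostEdge j with suc (toℕ j) <? k
  ... | yes sj = link-HostEdge (toℕ j) sj
  ... | no _ = Wrap-HostEdge

  EP-HostEdge : ∀ {Q : Path (Adj G)} → (∀ {y z} → Consec y z (toList (verts Q)) → HostEdge y z) →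
                ∀ {y z} → EP Q y z → HostEdge y z
  EP-HostEdge edge (inj₁ cs) = edge cs
  EP-HostEdge edge (inj₂ cs) = HostEdge-sym (edge cs)

  NecklaceEdge⇒HostEdge : ∀ {x y} → NecklaceEdge beads links x y → HostEdge x y
  NecklaceEdge⇒HostEdge (inj₁ (j , t , e)) = EP-HostEdge {leg (beads j) t} (BeadEdges.legs-HostEdge (toℕ j) (Fin.toℕ<n j) t) e
  NecklaceEdge⇒HostEdge (inj₂ (j , e)) = EP-HostEdge {links j} (links-HostEdge j) e

  above-foot-[] : ∀ r → mid r ≡ [] → above-foot r ≡ p (B r)
  above-foot-[] r eq rewrite eq = refl
  below-top-[] : ∀ r → mid r ≡ [] → below-top r ≡ c (A r)
  below-top-[] r eq rewrite eq = refl
  above-foot-[_] : ∀ r {w} → mid r ≡ w ∷ [] → above-foot r ≡ w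
  above-foot-[ r ] eq rewrite eq = refl
  below-top-[_] : ∀ r {w} → mid r ≡ w ∷ [] → below-top r ≡ w
  below-top-[ r ] eq rewrite eq = refl
  ∈-[_] : ∀ r {w} → mid r ≡ w ∷ [] → w ∈ mid r
  ∈-[ r ] eq = subst (_ ∈_) (sym eq) (here refl)

  HostVertex : V → Set
  HostVertex x = (∃ λ i → i < M × x ≡ c i) ⊎ (∃ λ i → i < L × x ≡ p i) ⊎
                 (∃ λ r → r < N × ∃ λ w → mid r ≡ w ∷ [] × x ≡ w)

  HostEdge⇒HostVertex : ∀ {x y} → HostEdge x y → HostVertex x
  HostEdge⇒HostVertex (cycle-step i i< e _) = inj₁ (i , <-trans (n<1+n i) i< , e)
  HostEdge⇒HostVertex (cycle-step⁻ i i< e _) = inj₁ (suc i , i< , e)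
  HostEdge⇒HostVertex (cycle-wrap 0< e _) = inj₁ (M ∸ 1 , pred< 0< , e)
  HostEdge⇒HostVertex (cycle-wrap⁻ 0< e _) = inj₁ (0 , 0< , e)
  HostEdge⇒HostVertex (path-step i i< e _) = inj₂ (inj₁ (i , <-trans (n<1+n i) i< , e))
  HostEdge⇒HostVertex (path-step⁻ i i< e _) = inj₂ (inj₁ (suc i , i< , e))
  HostEdge⇒HostVertex (rung-step r r< cs) with rung-Consec r cs | Rung.inner-short (rung r)
  ... | inj₁ (e , _) | _ = inj₁ (A r , A<M r , e)
  ... | inj₂ (e , _) | inj₁ eq = inj₁ (A r , A<M r , trans e (below-top-[] r eq))
  ... | inj₂ (e , _) | inj₂ (w , eq) = inj₂ (inj₂ (r , r< , w , eq , trans e (below-top-[ r ] eq)))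
  HostEdge⇒HostVertex (rung-step⁻ r r< cs) with rung-Consec r cs | Rung.inner-short (rung r)
  ... | inj₂ (_ , e) | _ = inj₂ (inj₁ (B r , B<L r , e))
  ... | inj₁ (_ , e) | inj₁ eq = inj₂ (inj₁ (B r , B<L r , trans e (above-foot-[] r eq)))
  ... | inj₁ (_ , e) | inj₂ (w , eq) = inj₂ (inj₂ (r , r< , w , eq , trans e (above-foot-[ r ] eq)))

  -- the three possible host neighbours of c i: its successor and predecessor on the cycle, and its rung
  CycleSlot : ℕ → Fin 3 → V → Set
  CycleSlot i zero y = ∃ λ i′ → ((suc i < M × i′ ≡ suc i) ⊎ (i ≡ M ∸ 1 × i′ ≡ 0)) × y ≡ c i′
  CycleSlot i (suc zero) y = ∃ λ i′ → ((i ≡ suc i′) ⊎ (i ≡ 0 × i′ ≡ M ∸ 1)) × y ≡ c i′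
  CycleSlot i (suc (suc zero)) y = ∃ λ r → r < N × A r ≡ i × y ≡ above-foot r

  CycleSlot-unique : ∀ i s y y′ → CycleSlot i s y → CycleSlot i s y′ → y ≡ y′
  CycleSlot-unique i zero y y′ (_ , inj₁ (_ , refl) , e) (_ , inj₁ (_ , refl) , e′) = trans e (sym e′)
  CycleSlot-unique i zero y y′ (_ , inj₁ (i< , _) , _) (_ , inj₂ (refl , _) , _) = ⊥-elim (<⇒≱ i< (≤-suc-pred M))
  CycleSlot-unique i zero y y′ (_ , inj₂ (refl , _) , _) (_ , inj₁ (i< , _) , _) = ⊥-elim (<⇒≱ i< (≤-suc-pred M))
  CycleSlot-unique i zero y y′ (_ , inj₂ (_ , refl) , e) (_ , inj₂ (_ , refl) , e′) = trans e (sym e′)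
  CycleSlot-unique i (suc zero) y y′ (_ , inj₁ eq , e) (_ , inj₁ eq′ , e′) =
    trans e (trans (cong c (suc-injective (trans (sym eq) eq′))) (sym e′))
  CycleSlot-unique i (suc zero) y y′ (_ , inj₁ eq , _) (_ , inj₂ (eq′ , _) , _) = ⊥-elim (0≢1+n (trans (sym eq′) eq))
  CycleSlot-unique i (suc zero) y y′ (_ , inj₂ (eq , _) , _) (_ , inj₁ eq′ , _) = ⊥-elim (0≢1+n (trans (sym eq) eq′))
  CycleSlot-unique i (suc zero) y y′ (_ , inj₂ (_ , refl) , e) (_ , inj₂ (_ , refl) , e′) = trans e (sym e′)
  CycleSlot-unique i (suc (suc zero)) y y′ (r , r< , eq , e) (r′ , r′< , eq′ , e′)
    with A-injective r r′ r< r′< (trans eq (sym eq′))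
  ... | refl = trans e (sym e′)

  cycle-slot : ∀ i → i < M → ∀ {x} → x ≡ c i → ∀ {y} → HostEdge x y → ∃ λ s → CycleSlot i s y
  cycle-slot i i<M x≡ (cycle-step i′ i′< e e′) with c-injective i i′ i<M (<-trans (n<1+n i′) i′<) (trans (sym x≡) e)
  ... | refl = zero , suc i , inj₁ (i′< , refl) , e′
  cycle-slot i i<M x≡ (cycle-step⁻ i′ i′< e e′) = suc zero , i′ , inj₁ (c-injective i (suc i′) i<M i′< (trans (sym x≡) e)) , e′
  cycle-slot i i<M x≡ (cycle-wrap 0< e e′) = zero , 0 , inj₂ (c-injective i (M ∸ 1) i<M (pred< 0<) (trans (sym x≡) e) , refl) , e′
  cycle-slot i i<M x≡ (cycle-wrap⁻ 0< e e′) = suc zero , M ∸ 1 , inj₂ (c-injective i 0 i<M 0< (trans (sym x≡) e) , refl) , e′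
  cycle-slot i i<M x≡ (path-step i′ i′< e _) = ⊥-elim (c≢p i i′ i<M (<-trans (n<1+n i′) i′<) (trans (sym x≡) e))
  cycle-slot i i<M x≡ (path-step⁻ i′ i′< e _) = ⊥-elim (c≢p i (suc i′) i<M i′< (trans (sym x≡) e))
  cycle-slot i i<M x≡ (rung-step r r< cs) with rung-Consec r cs | Rung.inner-short (rung r)
  ... | inj₁ (e , e′) | _ = suc (suc zero) , r , r< , c-injective (A r) i (A<M r) i<M (trans (sym e) x≡) , e′
  ... | inj₂ (e , e′) | inj₁ eq = suc (suc zero) , r , r< ,
          c-injective (A r) i (A<M r) i<M (trans (sym (trans e (below-top-[] r eq))) x≡) , trans e′ (sym (above-foot-[] r eq))
  ... | inj₂ (e , _) | inj₂ (w , eq) = ⊥-elim (mid∉c r w i (∈-[ r ] eq) i<M (trans (sym (trans e (below-top-[ r ] eq))) x≡))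
  cycle-slot i i<M x≡ (rung-step⁻ r r< cs) with rung-Consec r cs | Rung.inner-short (rung r)
  ... | inj₂ (_ , e) | _ = ⊥-elim (c≢p i (B r) i<M (B<L r) (trans (sym x≡) e))
  ... | inj₁ (_ , e) | inj₁ eq = ⊥-elim (c≢p i (B r) i<M (B<L r) (trans (sym x≡) (trans e (above-foot-[] r eq))))
  ... | inj₁ (_ , e) | inj₂ (w , eq) = ⊥-elim (mid∉c r w i (∈-[ r ] eq) i<M (trans (sym (trans e (above-foot-[ r ] eq))) x≡))

  PathSlot : ℕ → Fin 3 → V → Set
  PathSlot i zero y = ∃ λ i′ → i′ ≡ suc i × y ≡ p i′
  PathSlot i (suc zero) y = ∃ λ i′ → i ≡ suc i′ × y ≡ p i′
  PathSlot i (suc (suc zero)) y = ∃ λ r → r < N × B r ≡ i × y ≡ below-top r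

  PathSlot-unique : ∀ i s y y′ → PathSlot i s y → PathSlot i s y′ → y ≡ y′
  PathSlot-unique i zero y y′ (_ , refl , e) (_ , refl , e′) = trans e (sym e′)
  PathSlot-unique i (suc zero) y y′ (_ , eq , e) (_ , eq′ , e′) = trans e (trans (cong p (suc-injective (trans (sym eq) eq′))) (sym e′))
  PathSlot-unique i (suc (suc zero)) y y′ (r , r< , eq , e) (r′ , r′< , eq′ , e′) with B-injective r r′ r< r′< (trans eq (sym eq′))
  ... | refl = trans e (sym e′)

  path-slot : ∀ i → i < L → ∀ {x} → x ≡ p i → ∀ {y} → HostEdge x y → ∃ λ s → PathSlot i s y
  path-slot i i<L x≡ (cycle-step i′ i′< e _) = ⊥-elim (c≢p i′ i (<-trans (n<1+n i′) i′<) i<L (trans (sym e) x≡))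
  path-slot i i<L x≡ (cycle-step⁻ i′ i′< e _) = ⊥-elim (c≢p (suc i′) i i′< i<L (trans (sym e) x≡))
  path-slot i i<L x≡ (cycle-wrap 0< e _) = ⊥-elim (c≢p (M ∸ 1) i (pred< 0<) i<L (trans (sym e) x≡))
  path-slot i i<L x≡ (cycle-wrap⁻ 0< e _) = ⊥-elim (c≢p 0 i 0< i<L (trans (sym e) x≡))
  path-slot i i<L x≡ (path-step i′ i′< e e′) with p-injective i i′ i<L (<-trans (n<1+n i′) i′<) (trans (sym x≡) e)
  ... | refl = zero , suc i , refl , e′
  path-slot i i<L x≡ (path-step⁻ i′ i′< e e′) = suc zero , i′ , p-injective i (suc i′) i<L i′< (trans (sym x≡) e) , e′
  path-slot i i<L x≡ (rung-step r r< cs) with rung-Consec r cs | Rung.inner-short (rung r)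
  ... | inj₁ (e , _) | _ = ⊥-elim (c≢p (A r) i (A<M r) i<L (trans (sym e) x≡))
  ... | inj₂ (e , _) | inj₁ eq = ⊥-elim (c≢p (A r) i (A<M r) i<L (trans (sym (trans e (below-top-[] r eq))) x≡))
  ... | inj₂ (e , _) | inj₂ (w , eq) = ⊥-elim (mid∉p r w i (∈-[ r ] eq) i<L (trans (sym (trans e (below-top-[ r ] eq))) x≡))
  path-slot i i<L x≡ (rung-step⁻ r r< cs) with rung-Consec r cs | Rung.inner-short (rung r)
  ... | inj₂ (e , e′) | _ = suc (suc zero) , r , r< , p-injective (B r) i (B<L r) i<L (trans (sym e′) x≡) , e
  ... | inj₁ (e , e′) | inj₁ eq = suc (suc zero) , r , r< ,
          p-injective (B r) i (B<L r) i<L (trans (sym (trans e′ (above-foot-[] r eq))) x≡) , trans e (sym (below-top-[] r eq))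
  ... | inj₁ (_ , e′) | inj₂ (w , eq) = ⊥-elim (mid∉p r w i (∈-[ r ] eq) i<L (trans (sym (trans e′ (above-foot-[ r ] eq))) x≡))

  InnerSlot : ℕ → Fin 3 → V → Set
  InnerSlot r zero y = y ≡ p (B r)
  InnerSlot r (suc zero) y = y ≡ c (A r)
  InnerSlot r (suc (suc zero)) y = ⊥

  InnerSlot-unique : ∀ r s y y′ → InnerSlot r s y → InnerSlot r s y′ → y ≡ y′
  InnerSlot-unique r zero y y′ e e′ = trans e (sym e′)
  InnerSlot-unique r (suc zero) y y′ e e′ = trans e (sym e′)
  InnerSlot-unique r (suc (suc zero)) y y′ ()

  inner-slot : ∀ r → r < N → ∀ {w} → mid r ≡ w ∷ [] → ∀ {x} → x ≡ w → ∀ {y} → HostEdge x y → ∃ λ s → InnerSlot r s y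
  inner-slot r r< eq x≡ (cycle-step i i< e _) = ⊥-elim (mid∉c r _ i (∈-[ r ] eq) (<-trans (n<1+n i) i<) (trans (sym x≡) e))
  inner-slot r r< eq x≡ (cycle-step⁻ i i< e _) = ⊥-elim (mid∉c r _ (suc i) (∈-[ r ] eq) i< (trans (sym x≡) e))
  inner-slot r r< eq x≡ (cycle-wrap 0< e _) = ⊥-elim (mid∉c r _ (M ∸ 1) (∈-[ r ] eq) (pred< 0<) (trans (sym x≡) e))
  inner-slot r r< eq x≡ (cycle-wrap⁻ 0< e _) = ⊥-elim (mid∉c r _ 0 (∈-[ r ] eq) 0< (trans (sym x≡) e))
  inner-slot r r< eq x≡ (path-step i i< e _) = ⊥-elim (mid∉p r _ i (∈-[ r ] eq) (<-trans (n<1+n i) i<) (trans (sym x≡) e))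
  inner-slot r r< eq x≡ (path-step⁻ i i< e _) = ⊥-elim (mid∉p r _ (suc i) (∈-[ r ] eq) i< (trans (sym x≡) e))
  inner-slot r r< eq x≡ (rung-step r′ r′< cs) with rung-Consec r′ cs | Rung.inner-short (rung r′)
  ... | inj₁ (e , _) | _ = ⊥-elim (mid∉c r _ (A r′) (∈-[ r ] eq) (A<M r′) (trans (sym x≡) e))
  ... | inj₂ (e , _) | inj₁ eq′ = ⊥-elim (mid∉c r _ (A r′) (∈-[ r ] eq) (A<M r′) (trans (sym x≡) (trans e (below-top-[] r′ eq′))))
  ... | inj₂ (e , e′) | inj₂ (w′ , eq′)
    with inner-disjoint r r′ _ r< r′< (∈-[ r ] eq) (subst (_∈ mid r′) (sym (trans (sym x≡) (trans e (below-top-[ r′ ] eq′)))) (∈-[ r′ ] eq′))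
  ...   | refl = zero , e′
  inner-slot r r< eq x≡ (rung-step⁻ r′ r′< cs) with rung-Consec r′ cs | Rung.inner-short (rung r′)
  ... | inj₂ (_ , e′) | _ = ⊥-elim (mid∉p r _ (B r′) (∈-[ r ] eq) (B<L r′) (trans (sym x≡) e′))
  ... | inj₁ (_ , e′) | inj₁ eq′ = ⊥-elim (mid∉p r _ (B r′) (∈-[ r ] eq) (B<L r′) (trans (sym x≡) (trans e′ (above-foot-[] r′ eq′))))
  ... | inj₁ (e , e′) | inj₂ (w′ , eq′)
    with inner-disjoint r r′ _ r< r′< (∈-[ r ] eq) (subst (_∈ mid r′) (sym (trans (sym x≡) (trans e′ (above-foot-[ r′ ] eq′)))) (∈-[ r′ ] eq′))
  ...   | refl = suc zero , e

  host-subcubic : ∀ x (f : Fin 4 → V) → (∀ s t → f s ≡ f t → s ≡ t) → (∀ t → HostEdge x (f t)) → ⊥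
  host-subcubic x f f-injective edge with HostEdge⇒HostVertex (edge zero)
  ... | inj₁ (i , i< , x≡) =
        no-four-in-three-slots (CycleSlot i) (CycleSlot-unique i) f f-injective (λ t → cycle-slot i i< x≡ (edge t))
  ... | inj₂ (inj₁ (i , i< , x≡)) =
        no-four-in-three-slots (PathSlot i) (PathSlot-unique i) f f-injective (λ t → path-slot i i< x≡ (edge t))
  ... | inj₂ (inj₂ (r , r< , w , eq , x≡)) =
        no-four-in-three-slots (InnerSlot r) (InnerSlot-unique r) f f-injective (λ t → inner-slot r r< eq x≡ (edge t))

  necklace : Necklace G k (suc d)
  necklace = record
    { Θ = beads ; P = links ; Θ-disjoint = Θ-disjoint ; P-disjoint = P-disjoint
    ; L₃-length = λ j → Bead.leg₃-length (toℕ j) (Fin.toℕ<n j)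
    ; P-link = P-link ; P-inner = P-inner
    ; connected = necklace-connected beads links P-link
    ; subcubic = λ x f f-injective edge → host-subcubic x f f-injective (λ t → NecklaceEdge⇒HostEdge (edge t)) }

∸≡suc∸suc : ∀ {a x} → x < a → a ∸ x ≡ suc (a ∸ suc x)
∸≡suc∸suc {suc a} (s≤s x≤a) = +-∸-assoc 1 x≤a

pred∸< : ∀ {l x} → x < l → pred l ∸ x < l
pred∸< {l} {x} x< = ≤-<-trans (m∸n≤m (pred l) x) (pred< (≤-<-trans z≤n x<))

module _ {n : ℕ} {G : Graph n} where

  cycleAndPath : (C : Cycle G) (P : Path (Adj G)) → Disjoint (VC C) (VP P) → CycleAndPath G
  cycleAndPath C P disjoint = record
    { M = length cs ; c = c
    ; c-injective = λ x y x< y< → at-injective c₀ (unique (cpath C)) x< y<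
    ; c-adjacent = λ x x< → at-Linked c₀ (linked (cpath C)) x<
    ; c-closes = subst (λ w → Adj G w (c 0)) (trans (last≡lastOf c₀ cs′) (lastOf≡at c₀ c₀ cs′)) (closes C)
    ; L = length ps ; p = p
    ; p-injective = λ x y x< y< → at-injective p₀ (unique P) x< y<
    ; p-adjacent = λ x x< → at-Linked p₀ (linked P) x<
    ; c≢p = λ x y x< y< eq → disjoint (c x) (at-∈ c₀ cs x<) (subst (_∈ ps) (sym eq) (at-∈ p₀ ps y<)) }
    where
    c₀ p₀ : Fin n
    c₀ = List⁺.head (verts (cpath C))
    p₀ = List⁺.head (verts P)
    cs′ cs ps : List (Fin n)
    cs′ = List⁺.tail (verts (cpath C))
    cs = toList (verts (cpath C))
    ps = toList (verts P)
    c p : ℕ → Fin n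
    c = at c₀ cs
    p = at p₀ ps

  reversePath : CycleAndPath G → CycleAndPath G
  reversePath F = record F
    { p = p′
    ; p-injective = λ x y x< y< eq → ∸-cancelˡ-≡ (<⇒≤pred x<) (<⇒≤pred y<) (p-injective _ _ (pred∸< x<) (pred∸< y<) eq)
    ; p-adjacent = p′-adjacent
    ; c≢p = λ x y x< y< → c≢p x (pred L ∸ y) x< (pred∸< y<) }
    where
    open CycleAndPath F
    p′ : ℕ → Fin n
    p′ x = p (pred L ∸ x)
    p′-adjacent : ∀ x → suc x < L → Adj G (p′ x) (p′ (suc x))
    p′-adjacent x x< = subst (λ z → Adj G (p z) (p′ (suc x))) (sym flip)
                         (Adj-sym G (p-adjacent (pred L ∸ suc x) (subst (_< L) flip (pred∸< (<-trans (n<1+n x) x<)))))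
      where
      flip : pred L ∸ x ≡ suc (pred L ∸ suc x)
      flip = ∸≡suc∸suc (<⇒≤pred x<)

  reverseRung : ∀ {F} → Rung F → Rung (reversePath F)
  reverseRung {F} ρ = record
    { foot = foot ; top = pred L ∸ top ; foot<M = foot<M ; top<L = pred∸< top<L
    ; inner = inner ; inner-short = inner-short ; inner∉c = inner∉c
    ; inner∉p = λ y x y∈ x< → inner∉p y (pred L ∸ x) y∈ (pred∸< x<)
    ; linked = subst (λ t → Linked (Adj G) (c foot ∷ inner ++ p t ∷ [])) (sym (m∸[m∸n]≡n (<⇒≤pred top<L))) (Rung.linked ρ) }
    where
    open CycleAndPath F
    open Rung ρ

  module _ (A B : VSet n) (A∩B : Disjoint A B) where

    -- a short A–B path read from its end in A to its end in B
    record Oriented (Q : Path (Adj G)) : Set where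
      field
        a b : Fin n
        inner : List (Fin n)
        a∈A : A a
        b∈B : B b
        inner-short : inner ≡ [] ⊎ ∃ λ w → inner ≡ w ∷ []
        linked : Linked (Adj G) (a ∷ inner ++ b ∷ [])
        inner∉ : ∀ y → y ∈ inner → ¬ A y × ¬ B y
        ⊆Q : ∀ {y} → y ∈ a ∷ inner ++ b ∷ [] → VP Q y

    orient : ∀ Q → IsABPath A B Q → len Q ≤ 2 → Oriented Q
    orient record { verts = x ∷ [] } (inj₁ (x∈A , x∈B) , _) _ = ⊥-elim (A∩B x x∈A x∈B)
    orient record { verts = x ∷ [] } (inj₂ (x∈B , x∈A) , _) _ = ⊥-elim (A∩B x x∈A x∈B)
    orient record { verts = x ∷ y ∷ [] ; linked = l } (inj₁ (x∈A , y∈B) , _) _ =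
      record { a = x ; b = y ; inner = [] ; a∈A = x∈A ; b∈B = y∈B ; inner-short = inj₁ refl
             ; linked = l ; inner∉ = λ _ () ; ⊆Q = λ y∈ → y∈ }
    orient record { verts = x ∷ y ∷ [] ; linked = xy ∷ [-] } (inj₂ (x∈B , y∈A) , _) _ =
      record { a = y ; b = x ; inner = [] ; a∈A = y∈A ; b∈B = x∈B ; inner-short = inj₁ refl
             ; linked = Adj-sym G xy ∷ [-] ; inner∉ = λ _ () ; ⊆Q = swap }
      where
      swap : ∀ {z} → z ∈ y ∷ x ∷ [] → z ∈ x ∷ y ∷ []
      swap (here e) = there (here e)
      swap (there (here e)) = here e
    orient Q@record { verts = x ∷ w ∷ y ∷ [] ; unique = (x≢w ∷ _) ∷ (w≢y ∷ []) ∷ _ ; linked = l }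
           (inj₁ (x∈A , y∈B) , avoid) _ =
      record { a = x ; b = y ; inner = w ∷ [] ; a∈A = x∈A ; b∈B = y∈B ; inner-short = inj₂ (w , refl)
             ; linked = l ; inner∉ = λ { _ (here refl) → (λ w∈A → avoid w w-inner (inj₁ w∈A)) , (λ w∈B → avoid w w-inner (inj₂ w∈B)) }
             ; ⊆Q = λ y∈ → y∈ }
      where
      w-inner : Inner Q w
      w-inner = there (here refl) , (λ e → x≢w (sym e)) , w≢y
    orient Q@record { verts = x ∷ w ∷ y ∷ [] ; unique = (x≢w ∷ _) ∷ (w≢y ∷ []) ∷ _ ; linked = xw ∷ wy ∷ [-] }
           (inj₂ (x∈B , y∈A) , avoid) _ =
      record { a = y ; b = x ; inner = w ∷ [] ; a∈A = y∈A ; b∈B = x∈B ; inner-short = inj₂ (w , refl)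
             ; linked = Adj-sym G wy ∷ Adj-sym G xw ∷ [-]
             ; inner∉ = λ { _ (here refl) → (λ w∈A → avoid w w-inner (inj₁ w∈A)) , (λ w∈B → avoid w w-inner (inj₂ w∈B)) }
             ; ⊆Q = reverse3 }
      where
      w-inner : Inner Q w
      w-inner = there (here refl) , (λ e → x≢w (sym e)) , w≢y
      reverse3 : ∀ {z} → z ∈ y ∷ w ∷ x ∷ [] → z ∈ x ∷ w ∷ y ∷ []
      reverse3 (here e) = there (there (here e))
      reverse3 (there (here e)) = there (here e)
      reverse3 (there (there (here e))) = here e
    orient record { verts = _ ∷ _ ∷ _ ∷ _ ∷ _ } _ (s≤s (s≤s ()))

module CloseRungs {n : ℕ} {G : Graph n} (C : Cycle G) (P : Path (Adj G)) {m : ℕ}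
                  (close : Close G m (VC C) (VP P)) where

  disjoint : Disjoint (VC C) (VP P)
  disjoint = proj₁ close

  Q : Fin m → Path (Adj G)
  Q = proj₁ (proj₂ close)

  F : CycleAndPath G
  F = cycleAndPath C P disjoint

  open CycleAndPath F

  private
    c₀ p₀ : Fin n
    c₀ = List⁺.head (verts (cpath C))
    p₀ = List⁺.head (verts P)

  short : ∀ t → IsABPath (VC C) (VP P) (Q t) × len (Q t) ≤ 2
  short = proj₁ (proj₂ (proj₂ close))

  RungIn : Fin m → Rung F → Set
  RungIn t ρ = ∀ {y} → y ∈ c (Rung.foot ρ) ∷ Rung.inner ρ ++ p (Rung.top ρ) ∷ [] → VP (Q t) y

  rungIn : ∀ t → Σ (Rung F) (RungIn t)
  rungIn t with orient {G = G} (VC C) (VP P) disjoint (Q t) (proj₁ (short t)) (proj₂ (short t))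
  ... | o with ∈⇒at c₀ (Oriented.a∈A o) | ∈⇒at p₀ (Oriented.b∈B o)
  ... | i , i< , cᵢ≡a | j , j< , pⱼ≡b = ρ , λ y∈ → ⊆Q (subst₂ (λ x z → _ ∈ x ∷ inner ++ z ∷ []) cᵢ≡a pⱼ≡b y∈)
    where
    open Oriented o
    ρ : Rung F
    ρ = record
      { foot = i ; top = j ; foot<M = i< ; top<L = j< ; inner = inner ; inner-short = inner-short
      ; inner∉c = λ y x y∈ x< eq → proj₁ (inner∉ y y∈) (subst (VC C) (sym eq) (at-∈ c₀ _ x<))
      ; inner∉p = λ y x y∈ x< eq → proj₂ (inner∉ y y∈) (subst (VP P) (sym eq) (at-∈ p₀ _ x<))
      ; linked = subst₂ (λ x z → Linked (Adj G) (x ∷ inner ++ z ∷ [])) (sym cᵢ≡a) (sym pⱼ≡b) (Oriented.linked o) }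

  rung : Fin m → Rung F
  rung t = proj₁ (rungIn t)

  same-path : ∀ s t {y} → VP (Q s) y → VP (Q t) y → s ≡ t
  same-path s t {y} y∈ y∈′ with s Fin.≟ t
  ... | yes s≡t = s≡t
  ... | no s≢t = ⊥-elim (proj₂ (proj₂ (proj₂ close)) s t s≢t y y∈ y∈′)

  foot-injective : ∀ s t → Rung.foot (rung s) ≡ Rung.foot (rung t) → s ≡ t
  foot-injective s t eq = same-path s t (proj₂ (rungIn s) (here refl)) (proj₂ (rungIn t) (here (cong c eq)))

  top-injective : ∀ s t → Rung.top (rung s) ≡ Rung.top (rung t) → s ≡ t
  top-injective s t eq = same-path s t (proj₂ (rungIn s) (∈-last (Rung.inner (rung s))))
                           (subst (λ z → VP (Q t) (p z)) (sym eq) (proj₂ (rungIn t) (∈-last (Rung.inner (rung t)))))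
    where
    ∈-last : ∀ {x z} ys → z ∈ x ∷ ys ++ z ∷ []
    ∈-last ys = there (∈-++⁺ʳ ys (here refl))

  inner-disjoint : ∀ s t {y} → y ∈ Rung.inner (rung s) → y ∈ Rung.inner (rung t) → s ≡ t
  inner-disjoint s t y∈ y∈′ = same-path s t (proj₂ (rungIn s) (there (∈-++⁺ˡ y∈))) (proj₂ (rungIn t) (there (∈-++⁺ˡ y∈′)))

module RungSelection {n : ℕ} {G : Graph n} {F : CycleAndPath G} {m : ℕ} (t₀ : Fin m) (rung : Fin m → Rung F)
  (foot-injective : ∀ s t → Rung.foot (rung s) ≡ Rung.foot (rung t) → s ≡ t)
  (top-injective : ∀ s t → Rung.top (rung s) ≡ Rung.top (rung t) → s ≡ t)
  (inner-disjoint : ∀ s t {y} → y ∈ Rung.inner (rung s) → y ∈ Rung.inner (rung t) → s ≡ t) where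

  open CycleAndPath F

  foot top : Fin m → ℕ
  foot t = Rung.foot (rung t)
  top t = Rung.top (rung t)

  FootOfLength : ℕ → ℕ → Set
  FootOfLength d x = ∃ λ t → foot t ≡ x × length (Rung.inner (rung t)) ≡ d

  footOfLength? : ∀ d x → Dec (FootOfLength d x)
  footOfLength? d x = Fin.any? (λ t → (foot t ≟ x) ×-dec (length (Rung.inner (rung t)) ≟ d))

  feet : ℕ → List ℕ
  feet d = filter (footOfLength? d) (upTo M)

  rungAt : ℕ → ℕ → Fin m
  rungAt d x with footOfLength? d x
  ... | yes (t , _) = t
  ... | no _ = t₀

  rungAt-spec : ∀ {d x} → FootOfLength d x → foot (rungAt d x) ≡ x × length (Rung.inner (rung (rungAt d x))) ≡ d
  rungAt-spec {d} {x} has with footOfLength? d x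
  ... | yes (_ , spec) = spec
  ... | no hasn't = ⊥-elim (hasn't has)

  feet-cover : m ≤ length (feet 0) + length (feet 1)
  feet-cover = subst (m ≤_) (List.length-++ (feet 0)) (∈-injection⇒≤length (feet 0 ++ feet 1) foot foot-injective foot∈)
    where
    foot∈ : ∀ t → foot t ∈ feet 0 ++ feet 1
    foot∈ t with Rung.inner-short (rung t)
    ... | inj₁ eq = ∈-++⁺ˡ (∈-filter⁺ (footOfLength? 0) (∈-upTo⁺ (Rung.foot<M (rung t))) (t , refl , cong length eq))
    ... | inj₂ (_ , eq) = ∈-++⁺ʳ (feet 0) (∈-filter⁺ (footOfLength? 1) (∈-upTo⁺ (Rung.foot<M (rung t))) (t , refl , cong length eq))

  module _ (d : ℕ) where

    topAt : ℕ → ℕ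
    topAt x = top (rungAt d x)

    feet-sorted : AllPairs _<_ (feet d)
    feet-sorted = AllPairs.filter⁺ (footOfLength? d) (AllPairs.applyUpTo⁺₁ (λ i → i) M (λ i<j _ → i<j))

    feet-have : All (FootOfLength d) (feet d)
    feet-have = All.all-filter (footOfLength? d) (upTo M)

    feet-tops-distinct : AllPairs (λ x y → topAt x ≢ topAt y) (feet d)
    feet-tops-distinct = AllPairs-zipWith-All {R = _<_} {S = _<_} apart feet-have feet-sorted feet-sorted
      where
      apart : ∀ {x y} → FootOfLength d x → FootOfLength d y → x < y → x < y → topAt x ≢ topAt y
      apart hx hy x<y _ eq = <⇒≢ x<y
        (trans (sym (proj₁ (rungAt-spec hx))) (trans (cong foot (top-injective _ _ eq)) (proj₁ (rungAt-spec hy))))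

    module Along (ys : List ℕ) (ys⊆ : ys ⊆ feet d) where

      A : ℕ → ℕ
      A = at 0 ys

      A-has : ∀ {r} → r < length ys → FootOfLength d (A r)
      A-has r< = All.lookup feet-have (lookup ys⊆ (at-∈ 0 ys r<))

      rungOf : ℕ → Rung F
      rungOf r = rung (rungAt d (A r))

      foot-rungOf : ∀ {r} → r < length ys → Rung.foot (rungOf r) ≡ A r
      foot-rungOf r< = proj₁ (rungAt-spec (A-has r<))

      A-increasing : ∀ r s → r < s → s < length ys → A r < A s
      A-increasing r s r<s s< = at-AllPairs 0 (AllPairs-resp-⊆ ys⊆ feet-sorted) r<s s<

      foot-increasing : ∀ r s → r < s → s < length ys → Rung.foot (rungOf r) < Rung.foot (rungOf s)
      foot-increasing r s r<s s< =
        subst₂ _<_ (sym (foot-rungOf (<-trans r<s s<))) (sym (foot-rungOf s<)) (A-increasing r s r<s s<)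

      inner-disjoint′ : ∀ r s y → r < length ys → s < length ys →
                        y ∈ Rung.inner (rungOf r) → y ∈ Rung.inner (rungOf s) → r ≡ s
      inner-disjoint′ r s y r< s< y∈ y∈′ with <-cmp r s
      ... | tri≈ _ r≡s _ = r≡s
      ... | tri< r<s _ _ = ⊥-elim (<⇒≢ (foot-increasing r s r<s s<) (cong (λ t → foot t) (inner-disjoint _ _ y∈ y∈′)))
      ... | tri> _ _ s<r = ⊥-elim (<⇒≢ (foot-increasing s r s<r r<) (cong (λ t → foot t) (inner-disjoint _ _ y∈′ y∈)))

      rising-ladder : AllPairs (λ x y → topAt x < topAt y) ys → Ladder F (length ys) d
      rising-ladder rising = record
        { rung = rungOf
        ; inner-length = λ r r< → proj₂ (rungAt-spec (A-has r<))
        ; foot-increasing = foot-increasing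
        ; top-increasing = λ r s r<s s< → at-AllPairs 0 rising r<s s<
        ; inner-disjoint = inner-disjoint′ }

      -- falling tops rise once the path is traversed backwards
      falling-ladder : AllPairs (λ x y → topAt y < topAt x) ys → Ladder (reversePath F) (length ys) d
      falling-ladder falling = record
        { rung = λ r → reverseRung (rungOf r)
        ; inner-length = λ r r< → proj₂ (rungAt-spec (A-has r<))
        ; foot-increasing = foot-increasing
        ; top-increasing = λ r s r<s s< → ∸-monoʳ-< (at-AllPairs 0 falling r<s s<) (<⇒≤pred (Rung.top<L (rungOf r)))
        ; inner-disjoint = inner-disjoint′ }

    monotone-ladder : ∀ q → suc (q * q) ≤ length (feet d) → Ladder F (suc q) d ⊎ Ladder (reversePath F) (suc q) d
    monotone-ladder q long with ErdősSzekeres.erdős-szekeres topAt q (feet d) feet-tops-distinct long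
    ... | ys , ys⊆ , len , inj₁ rising = inj₁ (subst (λ N → Ladder F N d) len (Along.rising-ladder ys ys⊆ rising))
    ... | ys , ys⊆ , len , inj₂ falling = inj₂ (subst (λ N → Ladder (reversePath F) N d) len (Along.falling-ladder ys ys⊆ falling))

empty-necklace : ∀ {n} (G : Graph n) i → Necklace G 0 i
empty-necklace G i = record
  { Θ = λ () ; P = λ () ; Θ-disjoint = λ () ; P-disjoint = λ () ; L₃-length = λ ()
  ; P-link = λ () ; P-inner = λ ()
  ; connected = λ { _ _ (inj₁ (() , _)) _ ; _ _ (inj₂ (() , _)) _ }
  ; subcubic = λ { _ _ _ edge → no-edge (edge zero) } }
  where
  no-edge : ∀ {X Y : Fin 0 → Set} → Σ (Fin 0) X ⊎ Σ (Fin 0) Y → ⊥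
  no-edge (inj₁ (() , _))
  no-edge (inj₂ (() , _))

ladder⇒necklace : ∀ {n} {G : Graph n} {F : CycleAndPath G} {K d} →
                  Ladder F (3 + 3 * K) d → Necklace G (suc K) (suc d)
ladder⇒necklace {F = F} {K} {d} ladder = FromLadder.necklace (subst (λ N → Ladder F N d) (sym (*-suc 3 K)) ladder)

half-≤ : ∀ {h a b} → h + h ≤ a + b → h ≤ a ⊎ h ≤ b
half-≤ {h} {a} {b} 2h≤ with h ≤? a | h ≤? b
... | yes h≤a | _ = inj₁ h≤a
... | no _ | yes h≤b = inj₂ h≤b
... | no h≰a | no h≰b = ⊥-elim (<⇒≱ (+-mono-< (≰⇒> h≰a) (≰⇒> h≰b)) 2h≤)

square-bound : ∀ K → suc ((2 + 3 * K) * (2 + 3 * K)) ≤ 9 * (suc K * suc K)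
square-bound K = ≤-trans (*-mono-< (n<1+n (2 + 3 * K)) (n<1+n (2 + 3 * K)))
                   (≤-reflexive (solve 1 (λ k → (con 3 :+ con 3 :* k) :* (con 3 :+ con 3 :* k) := con 9 :* ((con 1 :+ k) :* (con 1 :+ k))) refl K))
  where open +-*-Solver

lemma2p5 : (k : ℕ) {n : ℕ} (G : Graph n) (C : Cycle G) (P : Path (Adj G)) →
           Close G (18 * (k * k)) (VC C) (VP P) →
           Necklace G k 1 ⊎ Necklace G k 2
lemma2p5 zero G C P close = inj₁ (empty-necklace G 1)
lemma2p5 (suc K) G C P close = Data.Sum.map (necklaceOfLength 0) (necklaceOfLength 1) (half-≤ feet-cover′)
  where
  open CloseRungs C P close
  open RungSelection zero rung foot-injective top-injective inner-disjoint
  feet-cover′ : 9 * (suc K * suc K) + 9 * (suc K * suc K) ≤ length (feet 0) + length (feet 1)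
  feet-cover′ = subst (_≤ length (feet 0) + length (feet 1)) (*-distribʳ-+ (suc K * suc K) 9 9) feet-cover
  necklaceOfLength : ∀ d → 9 * (suc K * suc K) ≤ length (feet d) → Necklace G (suc K) (suc d)
  necklaceOfLength d many = [ ladder⇒necklace , ladder⇒necklace ]′ (monotone-ladder d (2 + 3 * K) (≤-trans (square-bound K) many))
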